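{- Let $b\ge3$ be odd. Then: 1. For every odd $a\in RRS^*(b)$, the sequence $\big(\mathrm{mod}^*(a\,2^j,b)\big)_{j\ge1}$ is purely periodic. Its primitive period length does not depend on $a$; denote it $P(b)$. 2. $P(b)$ is the least positive integer $k$ with $2^k\equiv\pm1\pmod b$. Hence $P(b)=k(b)=\mathrm{pes}(b)$. 3. For each $i$, the last entry of the period $MDS(b,i)=(c_1,\dots,c_{P(b)})$ is the input: $c_{P(b)}=a(b,i)$. 4. $\bigcup_{i=1}^{c^*(b)}\{\text{entries of } MDS(b,i)\}=RRS^*(b)$. 5. $c^*(b)\,P(b)=\varphi(b)/2$. Consequently $c^*(b)=c(b)=B(b)$.
   Context: Throughout, $b\ge3$ is odd. Reduced residues. - $RRS^*(b)=\{r\in\mathbb Z:1\le r\le (b-1)/2,\ \gcd(r,b)=1\}$; it has $\varphi(b)/2$ elements. - For $m$ coprime to $b$, $\mathrm{mod}(m,b)\in\{0,\dots,b-1\}$ is the least non-negative residue. - $\mathrm{mod}^*(m,b)=\mathrm{mod}(m,b)$ if $\mathrm{mod}(m,b)\le b/2$, and $\mathrm{mod}^*(m,b)=\mathrm{mod}(-m,b)$ otherwise; thus $\mathrm{mod}^*(m,b)\in RRS^*(b)$. The MDS system. - Inputs: $a(b,1)=1$, and $a(b,i+1)$ is the smallest odd element of $RRS^*(b)$ not occurring in any of the sequences $\big(\mathrm{mod}^*(a(b,l)2^j,b)\big)_{j\ge1}$, $l\le i$. - The process stops once every odd element of $RRS^*(b)$ has occurred; $c^*(b)$ is the number of inputs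 used. - $MDS(b,i)=(c_1,\dots,c_{P(b)})$ is the first primitive period of $\big(\mathrm{mod}^*(a(b,i)2^j,b)\big)_{j\ge1}$. Schick cycles. - Let $O(b)$ be the odd integers in $[1,b-1]$ coprime to $b$; the map $q\mapsto|b-2q|$ permutes $O(b)$. - $\mathrm{pes}(b)$ is the length of its cycle containing $1$ (all its cycles have this length), and $B(b)$ is its number of cycles. Hilton–Pedersen coaches. - For odd $a_1$ with $1\le a_1<b/2$ and $\gcd(a_1,b)=1$, set $a_{j+1}=(b-a_j)/2^{k_j}$, where $k_j$ is the $2$-adic valuation of $b-a_j$. Let $r$ be the least $r\ge1$ with $a_{r+1}=a_1$. - The coach with input $a_1$ is the pair of rows $A=(a_1,\dots,a_r)$ and $K=(k_1,\dots,k_r)$. - The upper rows of the coaches partition the odd elements of $RRS^*(b)$. $c(b)$ is the number of coaches, and $k(b)=\sum_j k_j$, which is the same for every coach (the quasi-order of $2$ mod $b$). -}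

module Defs where

open import Data.Nat
open import Data.Nat.DivMod using (_%_; _/_)
open import Data.Nat.Coprimality using (Coprime; coprime?)
open import Data.Bool using (Bool; true; false; if_then_else_; _∧_)
open import Data.List using (List; upTo; map; length; filterᵇ)
open import Data.Nat.ListAction using (sum)
open import Data.Bool.ListAction using (all)
open import Data.Product using (Σ; _×_; ∃-syntax)
open import Data.Sum using (_⊎_)
open import Relation.Nullary using (¬_)
open import Relation.Nullary.Decidable using (⌊_⌋)
open import Relation.Binary.PropositionalEquality using (_≡_)

iter : (ℕ → ℕ) → ℕ → ℕ → ℕ
iter f zero    x = x
iter f (suc n) x = f (iter f n x)

Odd : ℕ → Set
Odd n = n % 2 ≡ 1

oddᵇ : ℕ → Bool
oddᵇ n = (n % 2) ≡ᵇ 1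

-- least non-negative residue mod(m,b) (b = 0 never used)
mod : ℕ → ℕ → ℕ
mod zero    m = 0
mod (suc n) m = m % suc n

modStar : ℕ → ℕ → ℕ
modStar b m = if 2 * mod b m ≤ᵇ b then mod b m else b ∸ mod b m

RRS* : ℕ → ℕ → Set
RRS* b r = 1 ≤ r × r ≤ (b ∸ 1) / 2 × Coprime r b

rrsᵇ : ℕ → ℕ → Bool
rrsᵇ b r = (1 ≤ᵇ r) ∧ (r ≤ᵇ (b ∸ 1) / 2) ∧ ⌊ coprime? r b ⌋

OddRRS : ℕ → ℕ → Set
OddRRS b x = Odd x × RRS* b x

φ : ℕ → ℕ
φ b = length (filterᵇ (λ r → ⌊ coprime? r b ⌋) (upTo b))

IsLeastPos : (ℕ → Set) → ℕ → Set
IsLeastPos P k = 1 ≤ k × P k × (∀ m → 1 ≤ m → P m → k ≤ m)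

seq : ℕ → ℕ → ℕ → ℕ
seq b a j = modStar b (a * 2 ^ j)

IsPeriod : ℕ → ℕ → ℕ → Set
IsPeriod b a p = 1 ≤ p × (∀ j → 1 ≤ j → seq b a (j + p) ≡ seq b a j)

IsPrimPeriod : ℕ → ℕ → ℕ → Set
IsPrimPeriod b a p = IsPeriod b a p × (∀ q → IsPeriod b a q → p ≤ q)

PlusMinusOne : ℕ → ℕ → Set
PlusMinusOne b k = mod b (2 ^ k) ≡ 1 ⊎ mod b (2 ^ k) ≡ b ∸ 1

-- MDS system.  a : ℕ → ℕ lists the inputs a(b,1), …, a(b,c) (1-based).

Occurs : ℕ → ℕ → ℕ → Set
Occurs b a x = ∃[ j ] (1 ≤ j × seq b a j ≡ x)

OccursBefore : ℕ → (ℕ → ℕ) → ℕ → ℕ → Set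
OccursBefore b a i x = ∃[ l ] (1 ≤ l × l ≤ i × Occurs b (a l) x)

IsMDSInputs : ℕ → ℕ → (ℕ → ℕ) → Set
IsMDSInputs b c a =
  1 ≤ c ×
  a 1 ≡ 1 ×
  (∀ i → 1 ≤ i → i < c →
      OddRRS b (a (suc i)) ×
      ¬ OccursBefore b a i (a (suc i)) ×
      (∀ x → OddRRS b x → ¬ OccursBefore b a i x → a (suc i) ≤ x)) ×
  (∀ x → OddRRS b x → OccursBefore b a c x)

-- 2-adic valuation and odd part (fuel n suffices for argument n)

v2-fuel : ℕ → ℕ → ℕ
v2-fuel zero    n = 0
v2-fuel (suc f) n = if (1 ≤ᵇ n) ∧ ((n % 2) ≡ᵇ 0) then suc (v2-fuel f (n / 2)) else 0

v2 : ℕ → ℕ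
v2 n = v2-fuel n n

oddPart-fuel : ℕ → ℕ → ℕ
oddPart-fuel zero    n = n
oddPart-fuel (suc f) n = if (1 ≤ᵇ n) ∧ ((n % 2) ≡ᵇ 0) then oddPart-fuel f (n / 2) else n

oddPart : ℕ → ℕ
oddPart n = oddPart-fuel n n

coachStep : ℕ → ℕ → ℕ
coachStep b a = oddPart (b ∸ a)

CoachLength : ℕ → ℕ → ℕ → Set
CoachLength b a₁ r = IsLeastPos (λ n → iter (coachStep b) n a₁ ≡ a₁) r

coachK : ℕ → ℕ → ℕ → ℕ
coachK b a₁ r = sum (map (λ j → v2 (b ∸ iter (coachStep b) j a₁)) (upTo r))

-- q is the least element of its orbit under f (orbits of length ≤ bound)
cycleMinᵇ : (ℕ → ℕ) → ℕ → ℕ → Bool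
cycleMinᵇ f bound q = all (λ n → q ≤ᵇ iter f n q) (upTo bound)

-- c(b): number of coaches = number of cycles of coachStep on the odd elements of RRS*(b)
numCoaches : ℕ → ℕ
numCoaches b = length (filterᵇ (λ q → oddᵇ q ∧ rrsᵇ b q ∧ cycleMinᵇ (coachStep b) b q) (upTo b))

schick : ℕ → ℕ → ℕ
schick b q = ∣ b - 2 * q ∣

Oᵇ : ℕ → ℕ → Bool
Oᵇ b q = oddᵇ q ∧ (1 ≤ᵇ q) ∧ (q <ᵇ b) ∧ ⌊ coprime? q b ⌋

IsPes : ℕ → ℕ → Set
IsPes b p = IsLeastPos (λ n → iter (schick b) n 1 ≡ 1) p

numSchickCycles : ℕ → ℕ
numSchickCycles b = length (filterᵇ (λ q → Oᵇ b q ∧ cycleMinᵇ (schick b) b q) (upTo b))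

{-# OPTIONS --safe #-}
-- Modulo b, mod*(a 2^j, b) is the representative in [1, b/2] of ±a 2^j, so each sequence is the
-- orbit of a under doubling in the group of units modulo b taken up to sign. Doubling is invertible
-- there, so every orbit is a cycle whose length is the order P of 2 in that group, the least k with
-- 2^k ≡ ±1, and its P-th entry is a itself. Every orbit contains odd elements (divide out the
-- powers of 2), and the MDS inputs are exactly the least odd elements of the orbits; hence the
-- orbits split RRS*(b) into c*(b) classes of size P, and RRS*(b) together with the negatives b - r
-- is the whole unit group, giving c*(b) P = φ(b)/2. Read inside an orbit, a coach step
-- x ↦ (b - x)/2^k moves back k places and the Schick map q ↦ |b - 2q| doubles up to sign; so the
-- coach through 1 has total weight P, the Schick cycle through 1 has length P, and coaches and
-- Schick cycles are again counted by the orbit minima.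
module Submission where

open import Defs
open import Data.Bool using (Bool; true; false; T; _∧_)
open import Data.Bool.ListAction using (all)
open import Data.Bool.Properties using (T-∧)
open import Data.Empty using (⊥; ⊥-elim)
open import Data.Fin using (Fin; toℕ; fromℕ<)
open import Data.Fin.Properties using (pigeonhole; toℕ-fromℕ<; toℕ<n)
open import Data.List using (upTo; filterᵇ; length; map; _++_; [_])
open import Data.List.Properties using (upTo-∷ʳ; length-++; filter-++; map-++)
open import Data.List.Relation.Unary.All.Properties using (all⁺; all⁻; applyUpTo⁺₁; applyUpTo⁻)
open import Data.Nat
open import Data.Nat.Coprimality using (Coprime; coprime?; coprime-divisor) renaming (sym to coprime-sym)
open import Data.Nat.DivMod
open import Data.Nat.Divisibility
open import Data.Nat.Induction using (<-rec)
open import Data.Nat.ListAction using (sum)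
open import Data.Nat.ListAction.Properties using (sum-++)
open import Data.Nat.Properties
open import Data.Nat.Solver using (module +-*-Solver)
open import Data.Product using (Σ; _×_; _,_; ∃-syntax; proj₁; proj₂)
open import Data.Sum using (_⊎_; inj₁; inj₂)
open import Function using (_∘_; _⇔_; mk⇔; Equivalence; case_of_)
open import Level using (0ℓ)
open import Relation.Binary using (Setoid; tri<; tri≈; tri>)
import Relation.Binary.Reasoning.Setoid as SetoidReasoning
open import Relation.Binary.PropositionalEquality hiding ([_])
open import Relation.Nullary using (Dec; yes; no; ¬_; _×-dec_)
open import Relation.Nullary.Decidable using (T?; toWitness; fromWitness; ⌊_⌋)
open import Relation.Unary using (Decidable)

module _ {Q : ℕ → Set} (Q? : Decidable Q) where

  IsLeastPos-lowest : ∀ m → 1 ≤ m → Q m → ∃[ k ] (k ≤ m × IsLeastPos Q k)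
  IsLeastPos-lowest = <-rec _ lowest
    where
    lowest : ∀ m → (∀ {n} → n < m → 1 ≤ n → Q n → ∃[ k ] (k ≤ n × IsLeastPos Q k)) →
             1 ≤ m → Q m → ∃[ k ] (k ≤ m × IsLeastPos Q k)
    lowest m below 1≤m Qm with anyUpTo? (λ n → 1 ≤? n ×-dec Q? n) m
    ... | yes (n , n<m , 1≤n , Qn) = let k , k≤n , least = below n<m 1≤n Qn in k , ≤-trans k≤n (<⇒≤ n<m) , least
    ... | no none = m , ≤-refl , 1≤m , Qm , λ n 1≤n Qn → ≮⇒≥ λ n<m → none (n , n<m , 1≤n , Qn)

IsLeastPos-resp : ∀ {Q R : ℕ → Set} {k} → (∀ m → 1 ≤ m → Q m → R m) → (∀ m → 1 ≤ m → R m → Q m) →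
                  IsLeastPos Q k → IsLeastPos R k
IsLeastPos-resp Q⇒R R⇒Q (1≤k , Qk , least) = 1≤k , Q⇒R _ 1≤k Qk , λ m 1≤m Rm → least m 1≤m (R⇒Q m 1≤m Rm)

Even : ℕ → Set
Even n = n % 2 ≡ 0

even⊎odd : ∀ n → Even n ⊎ Odd n
even⊎odd n with n % 2 | m%n<n n 2
... | 0 | _ = inj₁ refl
... | 1 | _ = inj₂ refl
... | suc (suc _) | s≤s (s≤s ())

¬even∧odd : ∀ {n} → Even n → Odd n → ⊥
¬even∧odd e o with trans (sym e) o
... | ()

%2-+ : ∀ {m n r s} → m % 2 ≡ r → n % 2 ≡ s → (m + n) % 2 ≡ (r + s) % 2
%2-+ {m} {n} p q = trans (%-distribˡ-+ m n 2) (cong₂ (λ u v → (u + v) % 2) p q)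

odd+odd : ∀ {m n} → Odd m → Odd n → Even (m + n)
odd+odd {m} {n} = %2-+ {m} {n}

even+odd : ∀ {m n} → Even m → Odd n → Odd (m + n)
even+odd {m} {n} = %2-+ {m} {n}

even+even : ∀ {m n} → Even m → Even n → Even (m + n)
even+even {m} {n} = %2-+ {m} {n}

odd-+-odd⇒even : ∀ {m n} → Odd (m + n) → Odd m → Even n
odd-+-odd⇒even {m} {n} o om with even⊎odd n
... | inj₁ en = en
... | inj₂ on = ⊥-elim (¬even∧odd {m + n} (odd+odd {m} {n} om on) o)

odd-+-even⇒odd : ∀ {m n} → Odd (m + n) → Even m → Odd n
odd-+-even⇒odd {m} {n} o em with even⊎odd n
... | inj₂ on = on
... | inj₁ en = ⊥-elim (¬even∧odd {m + n} (even+even {m} {n} em en) o)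

even-+-odd⇒odd : ∀ {m n} → Even (m + n) → Odd m → Odd n
even-+-odd⇒odd {m} {n} e om with even⊎odd n
... | inj₂ on = on
... | inj₁ en = ⊥-elim (¬even∧odd {n + m} (subst Even (+-comm m n) e) (even+odd {n} {m} en om))

even-2* : ∀ n → Even (2 * n)
even-2* n = trans (cong (_% 2) (*-comm 2 n)) (m*n%n≡0 n 2)

even-2^suc* : ∀ k n → Even (2 ^ suc k * n)
even-2^suc* k n = subst Even (sym (*-assoc 2 (2 ^ k) n)) (even-2* (2 ^ k * n))

odd⇒1≤ : ∀ {n} → Odd n → 1 ≤ n
odd⇒1≤ {suc _} _ = s≤s z≤n

2≤2^ : ∀ {k} → 1 ≤ k → 2 ≤ 2 ^ k
2≤2^ {suc k} _ = *-monoʳ-≤ 2 (m^n>0 2 k)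

oddPart-fuel-spec : ∀ f m → m ≤ f → 1 ≤ m → m ≡ 2 ^ v2-fuel f m * oddPart-fuel f m × Odd (oddPart-fuel f m)
oddPart-fuel-spec (suc f) m@(suc _) m≤f _ with (m % 2) ≡ᵇ 0 in parity
... | false = sym (+-identityʳ m) , odd
  where
  odd : Odd m
  odd with even⊎odd m
  ... | inj₂ o = o
  ... | inj₁ e = ⊥-elim (subst T parity (≡⇒≡ᵇ (m % 2) 0 e))
... | true = m≡ , proj₂ ih
  where
  m≡h*2 : m ≡ m / 2 * 2
  m≡h*2 = trans (m≡m%n+[m/n]*n m 2) (cong (_+ m / 2 * 2) (≡ᵇ⇒≡ (m % 2) 0 (subst T (sym parity) _)))
  1≤h : 1 ≤ m / 2
  1≤h with m / 2 in h≡
  ... | suc _ = s≤s z≤n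
  ... | zero with trans m≡h*2 (cong (_* 2) h≡)
  ...   | ()
  ih = oddPart-fuel-spec f (m / 2) (≤-pred (<-≤-trans (m/n<m m 2 (s≤s (s≤s z≤n))) m≤f)) 1≤h
  v = v2-fuel f (m / 2)
  o = oddPart-fuel f (m / 2)
  m≡ : m ≡ 2 ^ suc v * o
  m≡ = begin
    m               ≡⟨ m≡h*2 ⟩
    m / 2 * 2       ≡⟨ cong (_* 2) (proj₁ ih) ⟩
    2 ^ v * o * 2   ≡⟨ *-comm (2 ^ v * o) 2 ⟩
    2 * (2 ^ v * o) ≡⟨ *-assoc 2 (2 ^ v) o ⟨
    2 ^ suc v * o   ∎
    where open ≡-Reasoning

oddPart-spec : ∀ m → 1 ≤ m → m ≡ 2 ^ v2 m * oddPart m × Odd (oddPart m)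
oddPart-spec m = oddPart-fuel-spec m m ≤-refl

iter-suc′ : ∀ f m x → iter f (suc m) x ≡ iter f m (f x)
iter-suc′ f zero    x = refl
iter-suc′ f (suc m) x = cong f (iter-suc′ f m x)

module _ {d} .{{_ : NonZero d}} where

  %-/-injective : ∀ {k k'} → k % d ≡ k' % d → k / d ≡ k' / d → k ≡ k'
  %-/-injective {k} {k'} r≡ q≡ = begin
    k                ≡⟨ m≡m%n+[m/n]*n k d ⟩
    k % d + k / d * d   ≡⟨ cong₂ (λ r q → r + q * d) r≡ q≡ ⟩
    k' % d + k' / d * d ≡⟨ m≡m%n+[m/n]*n k' d ⟨
    k'               ∎
    where open ≡-Reasoning

  [r+q*d]%d≡r : ∀ {r} q → r < d → (r + q * d) % d ≡ r
  [r+q*d]%d≡r {r} q r<d = trans ([m+kn]%n≡m%n r q d) (m<n⇒m%n≡m r<d)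

  [r+q*d]/d≡q : ∀ {r} q → r < d → (r + q * d) / d ≡ q
  [r+q*d]/d≡q {r} q r<d = trans (+-distrib-/-∣ʳ r (n∣m*n q)) (cong₂ _+_ (m<n⇒m/n≡0 r<d) (m*n/n≡m q d))

Sum : (ℕ → ℕ) → ℕ → ℕ
Sum f zero    = 0
Sum f (suc n) = Sum f n + f n

Sum-cong : ∀ {f g} n → (∀ x → x < n → f x ≡ g x) → Sum f n ≡ Sum g n
Sum-cong zero    _  = refl
Sum-cong (suc n) eq = cong₂ _+_ (Sum-cong n λ x x<n → eq x (m<n⇒m<1+n x<n)) (eq n ≤-refl)

Sum-+ : ∀ f g n → Sum (λ x → f x + g x) n ≡ Sum f n + Sum g n
Sum-+ f g zero    = refl
Sum-+ f g (suc n) = trans (cong (_+ (f n + g n)) (Sum-+ f g n)) (+-+-comm (Sum f n) (Sum g n) (f n) (g n))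
  where
  +-+-comm : ∀ a b c d → a + b + (c + d) ≡ a + c + (b + d)
  +-+-comm a b c d = solve 4 (λ a b c d → a :+ b :+ (c :+ d) := a :+ c :+ (b :+ d)) refl a b c d
    where open +-*-Solver

Sum-zero : ∀ n → Sum (λ _ → 0) n ≡ 0
Sum-zero zero    = refl
Sum-zero (suc n) = cong (_+ 0) (Sum-zero n)

Sum-swap : ∀ (h : ℕ → ℕ → ℕ) m n → Sum (λ x → Sum (λ k → h k x) m) n ≡ Sum (λ k → Sum (h k) n) m
Sum-swap h m zero    = sym (Sum-zero m)
Sum-swap h m (suc n) = trans (cong (_+ Sum (λ k → h k n) m) (Sum-swap h m n))
                             (sym (Sum-+ (λ k → Sum (h k) n) (λ k → h k n) m))

Sum-vanishing : ∀ {f} n → (∀ x → x < n → f x ≡ 0) → Sum f n ≡ 0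
Sum-vanishing n f≡0 = trans (Sum-cong n f≡0) (Sum-zero n)

Sum-single : ∀ {f} n x₀ → x₀ < n → f x₀ ≡ 1 → (∀ x → x < n → x ≢ x₀ → f x ≡ 0) → Sum f n ≡ 1
Sum-single (suc n) x₀ x₀<1+n fx₀ others with m≤n⇒m<n∨m≡n (≤-pred x₀<1+n)
... | inj₁ x₀<n = cong₂ _+_ (Sum-single n x₀ x₀<n fx₀ λ x x<n → others x (m<n⇒m<1+n x<n))
                            (others n ≤-refl λ n≡x₀ → <⇒≢ x₀<n (sym n≡x₀))
... | inj₂ refl = cong₂ _+_ (Sum-vanishing n λ x x<n → others x (m<n⇒m<1+n x<n) (<⇒≢ x<n)) fx₀

Sum-one : ∀ n → Sum (λ _ → 1) n ≡ n
Sum-one zero    = refl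
Sum-one (suc n) = trans (cong (_+ 1) (Sum-one n)) (+-comm n 1)

sum-map-upTo : ∀ f n → sum (map f (upTo n)) ≡ Sum f n
sum-map-upTo f zero    = refl
sum-map-upTo f (suc n) = begin
  sum (map f (upTo (suc n)))        ≡⟨ cong (sum ∘ map f) (upTo-∷ʳ n) ⟨
  sum (map f (upTo n ++ [ n ]))     ≡⟨ cong sum (map-++ f (upTo n) [ n ]) ⟩
  sum (map f (upTo n) ++ [ f n ])   ≡⟨ sum-++ (map f (upTo n)) [ f n ] ⟩
  sum (map f (upTo n)) + (f n + 0)  ≡⟨ cong₂ _+_ (sum-map-upTo f n) (+-identityʳ (f n)) ⟩
  Sum f (suc n)                     ∎
  where open ≡-Reasoning

indicator : Bool → ℕ
indicator true  = 1
indicator false = 0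

indicator-T : ∀ {c} → T c → indicator c ≡ 1
indicator-T {true} _ = refl

indicator-¬T : ∀ {c} → ¬ T c → indicator c ≡ 0
indicator-¬T {false} _  = refl
indicator-¬T {true}  ¬t = ⊥-elim (¬t _)

count : (ℕ → Bool) → ℕ → ℕ
count p = Sum (indicator ∘ p)

length-filterᵇ-singleton : ∀ (p : ℕ → Bool) x → length (filterᵇ p [ x ]) ≡ indicator (p x)
length-filterᵇ-singleton p x with p x
... | true  = refl
... | false = refl

length-filterᵇ-upTo : ∀ p n → length (filterᵇ p (upTo n)) ≡ count p n
length-filterᵇ-upTo p zero    = refl
length-filterᵇ-upTo p (suc n) = begin
  length (filterᵇ p (upTo (suc n)))                      ≡⟨ cong (length ∘ filterᵇ p) (upTo-∷ʳ n) ⟨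
  length (filterᵇ p (upTo n ++ [ n ]))                   ≡⟨ cong length (filter-++ {P = T ∘ p} (T? ∘ p) (upTo n) [ n ]) ⟩
  length (filterᵇ p (upTo n) ++ filterᵇ p [ n ])         ≡⟨ length-++ (filterᵇ p (upTo n)) ⟩
  length (filterᵇ p (upTo n)) + length (filterᵇ p [ n ]) ≡⟨ cong₂ _+_ (length-filterᵇ-upTo p n)
                                                                      (length-filterᵇ-singleton p n) ⟩
  count p (suc n)                                        ∎
  where open ≡-Reasoning

δ : ℕ → ℕ → ℕ
δ m x = indicator (m ≡ᵇ x)

δ-refl : ∀ m → δ m m ≡ 1
δ-refl m = indicator-T (≡⇒≡ᵇ m m refl)

δ-≢ : ∀ {m x} → m ≢ x → δ m x ≡ 0
δ-≢ {m} {x} m≢x = indicator-¬T (m≢x ∘ ≡ᵇ⇒≡ m x)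

count-bijection : ∀ p n N (g : ℕ → ℕ) →
  (∀ k → k < N → g k < n × T (p (g k))) →
  (∀ k k' → k < N → k' < N → g k ≡ g k' → k ≡ k') →
  (∀ x → x < n → T (p x) → ∃[ k ] (k < N × g k ≡ x)) →
  count p n ≡ N
count-bijection p n N g into injective onto = begin
  count p n                             ≡⟨ Sum-cong n fibre ⟩
  Sum (λ x → Sum (λ k → δ (g k) x) N) n ≡⟨ Sum-swap (λ k → δ (g k)) N n ⟩
  Sum (λ k → Sum (δ (g k)) n) N         ≡⟨ Sum-cong N image ⟩
  Sum (λ _ → 1) N                       ≡⟨ Sum-one N ⟩
  N                                     ∎
  where
  open ≡-Reasoning
  image : ∀ k → k < N → Sum (δ (g k)) n ≡ 1
  image k k<N = Sum-single n (g k) (proj₁ (into k k<N)) (δ-refl (g k)) λ x _ x≢gk → δ-≢ (x≢gk ∘ sym)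
  fibre : ∀ x → x < n → indicator (p x) ≡ Sum (λ k → δ (g k) x) N
  fibre x x<n with T? (p x)
  ... | no ¬px = trans (indicator-¬T ¬px)
                       (sym (Sum-vanishing N λ k k<N → δ-≢ λ gk≡x → ¬px (subst (T ∘ p) gk≡x (proj₂ (into k k<N)))))
  ... | yes px with onto x x<n px
  ...   | k₀ , k₀<N , gk₀≡x = trans (indicator-T px) (sym (Sum-single N k₀ k₀<N δgk₀x≡1 others))
    where
    δgk₀x≡1 : δ (g k₀) x ≡ 1
    δgk₀x≡1 = trans (cong (λ y → δ y x) gk₀≡x) (δ-refl x)
    others : ∀ k → k < N → k ≢ k₀ → δ (g k) x ≡ 0
    others k k<N k≢k₀ = δ-≢ λ gk≡x → k≢k₀ (injective k k₀ k<N k₀<N (trans gk≡x (sym gk₀≡x)))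

count-suc-T : ∀ p {n} → T (p n) → count p (suc n) ≡ suc (count p n)
count-suc-T p {n} pn = trans (cong (count p n +_) (indicator-T pn)) (+-comm (count p n) 1)

count-suc-¬T : ∀ p {n} → ¬ T (p n) → count p (suc n) ≡ count p n
count-suc-¬T p {n} ¬pn = trans (cong (count p n +_) (indicator-¬T ¬pn)) (+-identityʳ (count p n))

count-strict : ∀ p {m n} → T (p m) → m < n → count p m < count p n
count-strict p {m} {suc n} pm (s≤s m≤n) with m≤n⇒m<n∨m≡n m≤n
... | inj₁ m<n  = <-≤-trans (count-strict p pm m<n) (m≤m+n (count p n) _)
... | inj₂ refl = ≤-reflexive (sym (count-suc-T p pm))

count-injective : ∀ p {m n} → T (p m) → T (p n) → count p m ≡ count p n → m ≡ n
count-injective p {m} {n} pm pn eq with <-cmp m n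
... | tri< m<n _ _ = ⊥-elim (<⇒≢ (count-strict p pm m<n) eq)
... | tri≈ _ m≡n _ = m≡n
... | tri> _ _ n<m = ⊥-elim (<⇒≢ (count-strict p pn n<m) (sym eq))

count-attains : ∀ p n v → v < count p n → ∃[ x ] (x < n × T (p x) × count p x ≡ v)
count-attains p (suc n) v v<count with v <? count p n
... | yes v<c = let x , x<n , px , cx≡v = count-attains p n v v<c in x , m<n⇒m<1+n x<n , px , cx≡v
... | no v≮c with T? (p n)
...   | yes pn = n , ≤-refl , pn , ≤-antisym (≮⇒≥ v≮c) (≤-pred (subst (v <_) (count-suc-T p pn) v<count))
...   | no ¬pn = ⊥-elim (v≮c (subst (v <_) (count-suc-¬T p ¬pn) v<count))

-- nth p n i is the i-th (counting from 1) element of {x < n ∣ p x} in increasing order, and 0 out of range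
module _ (p : ℕ → Bool) (n : ℕ) where

  nth : ℕ → ℕ
  nth i with i ∸ 1 <? count p n
  ... | yes i-1<count = proj₁ (count-attains p n (i ∸ 1) i-1<count)
  ... | no  _         = 0

  nth-spec : ∀ {i} → 1 ≤ i → i ≤ count p n → nth i < n × T (p (nth i)) × count p (nth i) ≡ i ∸ 1
  nth-spec {suc i} _ i<count with i <? count p n
  ... | yes i<count′ = proj₂ (count-attains p n i i<count′)
  ... | no  i≮count  = ⊥-elim (i≮count i<count)

  nth-rank : ∀ {x} → x < n → T (p x) → suc (count p x) ≤ count p n × nth (suc (count p x)) ≡ x
  nth-rank {x} x<n px = 1+rank≤count , count-injective p (proj₁ (proj₂ spec)) px (proj₂ (proj₂ spec))
    where
    1+rank≤count = count-strict p px x<n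
    spec = nth-spec (s≤s z≤n) 1+rank≤count

all-upTo⇔ : ∀ (p : ℕ → Bool) n → T (all p (upTo n)) ⇔ (∀ m → m < n → T (p m))
all-upTo⇔ p n = mk⇔ (λ t m m<n → applyUpTo⁻ _ n (all⁺ p (upTo n) t) m<n)
                    (λ h → all⁻ p (applyUpTo⁺₁ _ n λ {m} m<n → h m m<n))

T-cycleMinᵇ : ∀ f n q → T (cycleMinᵇ f n q) ⇔ (∀ m → m < n → q ≤ iter f m q)
T-cycleMinᵇ f n q = mk⇔ (λ t m m<n → ≤ᵇ⇒≤ q (iter f m q) (Equivalence.to (all-upTo⇔ _ n) t m m<n))
                        (λ below → Equivalence.from (all-upTo⇔ _ n) λ m m<n → ≤⇒≤ᵇ (below m m<n))

T-oddᵇ : ∀ q → T (oddᵇ q) ⇔ Odd q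
T-oddᵇ q = mk⇔ (≡ᵇ⇒≡ (q % 2) 1) (≡⇒≡ᵇ (q % 2) 1)

T-rrsᵇ : ∀ b q → T (rrsᵇ b q) ⇔ RRS* b q
T-rrsᵇ b q = mk⇔ to from
  where
  to : T (rrsᵇ b q) → RRS* b q
  to t = let t₁ , t₂₃ = Equivalence.to T-∧ t ; t₂ , t₃ = Equivalence.to T-∧ t₂₃
         in ≤ᵇ⇒≤ 1 q t₁ , ≤ᵇ⇒≤ q ((b ∸ 1) / 2) t₂ , toWitness t₃
  from : RRS* b q → T (rrsᵇ b q)
  from (1≤q , q≤ , q⊥b) =
    Equivalence.from T-∧ (≤⇒≤ᵇ 1≤q , Equivalence.from T-∧ (≤⇒≤ᵇ q≤ , fromWitness (λ {d} → q⊥b {d})))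

module Congruence (b : ℕ) {{_ : NonZero b}} where

  infix 4 _≋_ _~_ _~?_

  record _≋_ (x y : ℕ) : Set where
    constructor mk≋
    field ≋⇒%≡ : x % b ≡ y % b
  open _≋_ public

  ≋-refl : ∀ {x} → x ≋ x
  ≋-refl = mk≋ refl

  ≋-reflexive : ∀ {x y} → x ≡ y → x ≋ y
  ≋-reflexive refl = ≋-refl

  ≋-sym : ∀ {x y} → x ≋ y → y ≋ x
  ≋-sym (mk≋ p) = mk≋ (sym p)

  ≋-trans : ∀ {x y z} → x ≋ y → y ≋ z → x ≋ z
  ≋-trans (mk≋ p) (mk≋ q) = mk≋ (trans p q)

  ≋-setoid : Setoid 0ℓ 0ℓ
  ≋-setoid = record { Carrier = ℕ ; _≈_ = _≋_
                     ; isEquivalence = record { refl = ≋-refl ; sym = ≋-sym ; trans = ≋-trans } }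

  module ≋-Reasoning = SetoidReasoning ≋-setoid

  +-≋ : ∀ {x x' y y'} → x ≋ x' → y ≋ y' → x + y ≋ x' + y'
  +-≋ {x} {x'} {y} {y'} (mk≋ p) (mk≋ q) = mk≋ (begin
    (x + y) % b           ≡⟨ %-distribˡ-+ x y b ⟩
    (x % b + y % b) % b   ≡⟨ cong₂ (λ u v → (u + v) % b) p q ⟩
    (x' % b + y' % b) % b ≡⟨ %-distribˡ-+ x' y' b ⟨
    (x' + y') % b         ∎)
    where open ≡-Reasoning

  *-≋ : ∀ {x x' y y'} → x ≋ x' → y ≋ y' → x * y ≋ x' * y'
  *-≋ {x} {x'} {y} {y'} (mk≋ p) (mk≋ q) = mk≋ (begin
    (x * y) % b             ≡⟨ %-distribˡ-* x y b ⟩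
    (x % b * (y % b)) % b   ≡⟨ cong₂ (λ u v → (u * v) % b) p q ⟩
    (x' % b * (y' % b)) % b ≡⟨ %-distribˡ-* x' y' b ⟨
    (x' * y') % b           ∎)
    where open ≡-Reasoning

  %-≋ : ∀ x → x % b ≋ x
  %-≋ x = mk≋ (m%n%n≡m%n x b)

  0%b≡0 : 0 % b ≡ 0
  0%b≡0 = m<n⇒m%n≡m (>-nonZero⁻¹ b)

  ≋0⇒∣ : ∀ {x} → x ≋ 0 → b ∣ x
  ≋0⇒∣ {x} (mk≋ p) = m%n≡0⇒n∣m x b (trans p 0%b≡0)

  ∣⇒≋0 : ∀ {x} → b ∣ x → x ≋ 0
  ∣⇒≋0 {x} b∣x = mk≋ (trans (n∣m⇒m%n≡0 x b b∣x) (sym 0%b≡0))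

  b≋0 : b ≋ 0
  b≋0 = mk≋ (trans (n%n≡0 b) (sym 0%b≡0))

  +-≋0 : ∀ {x w} → w ≋ 0 → x + w ≋ x
  +-≋0 {x} w≋0 = ≋-trans (+-≋ (≋-refl {x}) w≋0) (≋-reflexive (+-identityʳ x))

  negate : ℕ → ℕ
  negate y = b ∸ y % b

  +-negate : ∀ y → y + negate y ≋ 0
  +-negate y = ≋-trans (+-≋ (≋-sym (%-≋ y)) (≋-refl {negate y}))
                       (≋-trans (≋-reflexive (m+[n∸m]≡n (<⇒≤ (m%n<n y b)))) b≋0)

  +-cancelʳ-≋ : ∀ {x y z} → x + z ≋ y + z → x ≋ y
  +-cancelʳ-≋ {x} {y} {z} p = begin
    x                    ≈⟨ +-≋0 (+-negate z) ⟨
    x + (z + negate z)   ≡⟨ +-assoc x z (negate z) ⟨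
    x + z + negate z     ≈⟨ +-≋ p (≋-refl {negate z}) ⟩
    y + z + negate z     ≡⟨ +-assoc y z (negate z) ⟩
    y + (z + negate z)   ≈⟨ +-≋0 (+-negate z) ⟩
    y                    ∎
    where open ≋-Reasoning

  *-cancelˡ-≋ : ∀ {c x y} → Coprime c b → c * x ≋ c * y → x ≋ y
  *-cancelˡ-≋ {c} {x} {y} c⊥b cx≋cy = +-cancelʳ-≋ {z = negate y} (≋-trans x-y≋0 (≋-sym (+-negate y)))
    where
    c[x-y]≋0 : c * (x + negate y) ≋ 0
    c[x-y]≋0 = begin
      c * (x + negate y)         ≡⟨ *-distribˡ-+ c x (negate y) ⟩
      c * x + c * negate y       ≈⟨ +-≋ cx≋cy (≋-refl {c * negate y}) ⟩
      c * y + c * negate y       ≡⟨ *-distribˡ-+ c y (negate y) ⟨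
      c * (y + negate y)         ≈⟨ *-≋ (≋-refl {c}) (+-negate y) ⟩
      c * 0                      ≡⟨ *-zeroʳ c ⟩
      0                          ∎
      where open ≋-Reasoning
    x-y≋0 : x + negate y ≋ 0
    x-y≋0 = ∣⇒≋0 (coprime-divisor (coprime-sym c⊥b) (≋0⇒∣ c[x-y]≋0))

  data _~_ (x y : ℕ) : Set where
    plus  : x ≋ y → x ~ y
    minus : x + y ≋ 0 → x ~ y

  ~-refl : ∀ {x} → x ~ x
  ~-refl = plus ≋-refl

  ~-reflexive : ∀ {x y} → x ≡ y → x ~ y
  ~-reflexive refl = ~-refl

  ~-sym : ∀ {x y} → x ~ y → y ~ x
  ~-sym (plus p) = plus (≋-sym p)
  ~-sym {x} {y} (minus p) = minus (≋-trans (≋-reflexive (+-comm y x)) p)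

  ~-trans : ∀ {x y z} → x ~ y → y ~ z → x ~ z
  ~-trans (plus p) (plus q) = plus (≋-trans p q)
  ~-trans {z = z} (plus p) (minus q) = minus (≋-trans (+-≋ p (≋-refl {z})) q)
  ~-trans {x} (minus p) (plus q) = minus (≋-trans (+-≋ (≋-refl {x}) (≋-sym q)) p)
  ~-trans {x} {y} {z} (minus p) (minus q) =
    plus (+-cancelʳ-≋ {z = y} (≋-trans p (≋-trans (≋-sym q) (≋-reflexive (+-comm y z)))))

  ~-setoid : Setoid 0ℓ 0ℓ
  ~-setoid = record { Carrier = ℕ ; _≈_ = _~_
                     ; isEquivalence = record { refl = ~-refl ; sym = ~-sym ; trans = ~-trans } }

  module ~-Reasoning = SetoidReasoning ~-setoid

  *-~ʳ : ∀ {x y} z → x ~ y → x * z ~ y * z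
  *-~ʳ z (plus p) = plus (*-≋ p (≋-refl {z}))
  *-~ʳ {x} {y} z (minus p) = minus (≋-trans (≋-reflexive (sym (*-distribʳ-+ z x y))) (*-≋ p (≋-refl {z})))

  *-~ˡ : ∀ {x y} z → x ~ y → z * x ~ z * y
  *-~ˡ {x} {y} z p = subst₂ _~_ (*-comm x z) (*-comm y z) (*-~ʳ z p)

  *-cancelˡ-~ : ∀ {c x y} → Coprime c b → c * x ~ c * y → x ~ y
  *-cancelˡ-~ c⊥b (plus p) = plus (*-cancelˡ-≋ c⊥b p)
  *-cancelˡ-~ {c} {x} {y} c⊥b (minus p) = minus (*-cancelˡ-≋ {c} c⊥b
    (≋-trans (≋-reflexive (*-distribˡ-+ c x y)) (≋-trans p (≋-reflexive (sym (*-zeroʳ c))))))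

  _~?_ : ∀ x y → Dec (x ~ y)
  x ~? y with x % b ≟ y % b | (x + y) % b ≟ 0 % b
  ... | yes p | _     = yes (plus (mk≋ p))
  ... | no _  | yes q = yes (minus (mk≋ q))
  ... | no ¬p | no ¬q = no λ { (plus (mk≋ p)) → ¬p p ; (minus (mk≋ q)) → ¬q q }

  ∣-resp-~ : ∀ {d x y} → d ∣ b → x ~ y → d ∣ x → d ∣ y
  ∣-resp-~ {d} {x} d∣b (plus (mk≋ p)) d∣x = ∣n∣m%n⇒∣m d∣b (subst (d ∣_) p d∣x%b)
    where
    d∣x%b : d ∣ x % b
    d∣x%b = ∣m+n∣m⇒∣n (subst (d ∣_) (trans (m≡m%n+[m/n]*n x b) (+-comm (x % b) (x / b * b))) d∣x)
                      (∣-trans d∣b (n∣m*n (x / b)))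
  ∣-resp-~ d∣b (minus p) d∣x = ∣m+n∣m⇒∣n (∣-trans d∣b (≋0⇒∣ p)) d∣x

  coprime-resp-~ : ∀ {x y} → x ~ y → Coprime x b → Coprime y b
  coprime-resp-~ x~y x⊥b (d∣y , d∣b) = x⊥b (∣-resp-~ d∣b (~-sym x~y) d∣y , d∣b)

  ~-below-b : ∀ {s t} → s < b → t < b → s ~ t → s ≡ t ⊎ s + t ≡ b
  ~-below-b s<b t<b (plus (mk≋ p)) = inj₁ (trans (sym (m<n⇒m%n≡m s<b)) (trans p (m<n⇒m%n≡m t<b)))
  ~-below-b {s} {t} s<b t<b (minus (mk≋ p)) with s + t <? b
  ... | yes s+t<b = inj₁ (trans (m+n≡0⇒m≡0 s s+t≡0) (sym (m+n≡0⇒n≡0 s s+t≡0)))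
    where
    s+t≡0 : s + t ≡ 0
    s+t≡0 = trans (sym (m<n⇒m%n≡m s+t<b)) (trans p 0%b≡0)
  ... | no s+t≮b = inj₂ (≤-antisym s+t≤b b≤s+t)
    where
    b≤s+t = ≮⇒≥ s+t≮b
    d = s + t ∸ b
    s+t≡d+b : s + t ≡ d + b
    s+t≡d+b = sym (m∸n+n≡m b≤s+t)
    d<b : d < b
    d<b = +-cancelʳ-< b d b (subst (_< b + b) s+t≡d+b (+-mono-< s<b t<b))
    d≡0 : d ≡ 0
    d≡0 = trans (sym (m<n⇒m%n≡m d<b)) (trans (sym ([m+n]%n≡m%n d b)) (trans (cong (_% b) (sym s+t≡d+b)) (trans p 0%b≡0)))
    s+t≤b : s + t ≤ b
    s+t≤b = ≤-reflexive (trans s+t≡d+b (cong (_+ b) d≡0))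

  coprime-* : ∀ {x y} → Coprime x b → Coprime y b → Coprime (x * y) b
  coprime-* {x} {y} x⊥b y⊥b {d} (d∣xy , d∣b) = x⊥b (coprime-divisor d⊥y (subst (d ∣_) (*-comm x y) d∣xy) , d∣b)
    where
    d⊥y : Coprime d y
    d⊥y (i∣d , i∣y) = y⊥b (i∣y , ∣-trans i∣d d∣b)

  coprime-1 : Coprime 1 b
  coprime-1 (d∣1 , _) = ∣1⇒≡1 d∣1

  coprime-b∸ : ∀ {y} → y ≤ b → Coprime y b → Coprime (b ∸ y) b
  coprime-b∸ {y} y≤b y⊥b {d} (d∣b∸y , d∣b) =
    y⊥b (∣m+n∣m⇒∣n (subst (d ∣_) (sym (m∸n+n≡m y≤b)) d∣b) d∣b∸y , d∣b)

module OddModulus (n : ℕ) (3≤b : 3 ≤ suc n) (b-odd : Odd (suc n)) where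

  b : ℕ
  b = suc n

  open Congruence b public

  1<b : 1 < b
  1<b = ≤-trans (n≤1+n 2) 3≤b

  b≢2* : ∀ s → b ≢ 2 * s
  b≢2* s b≡2s = ¬even∧odd {b} (subst Even (sym b≡2s) (even-2* s)) b-odd

  coprime-2 : Coprime 2 b
  coprime-2 {0} (0∣2 , _) with 0∣⇒≡0 0∣2
  ... | ()
  coprime-2 {1} _ = refl
  coprime-2 {2} (_ , 2∣b) = ⊥-elim (¬even∧odd {b} (n∣m⇒m%n≡0 b 2 2∣b) b-odd)
  coprime-2 {suc (suc (suc _))} (d∣2 , _) with ∣⇒≤ d∣2
  ... | s≤s (s≤s ())

  coprime-2^ : ∀ k → Coprime (2 ^ k) b
  coprime-2^ zero    = coprime-1
  coprime-2^ (suc k) = coprime-* coprime-2 (coprime-2^ k)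

  *-cancelˡ-~-2^ : ∀ k {x y} → 2 ^ k * x ~ 2 ^ k * y → x ~ y
  *-cancelˡ-~-2^ k = *-cancelˡ-~ (coprime-2^ k)

  coprime⇒1≤ : ∀ {x} → Coprime x b → 1 ≤ x
  coprime⇒1≤ {suc _} _   = s≤s z≤n
  coprime⇒1≤ {zero}  0⊥b = ⊥-elim (<⇒≢ 1<b (sym (0⊥b (b ∣0 , ∣-refl))))

  2*≤b⇒<b : ∀ {s} → 2 * s ≤ b → s < b
  2*≤b⇒<b {zero}  _    = s≤s z≤n
  2*≤b⇒<b {suc s} 2s≤b = <-≤-trans (s≤s (m<m+n s z<s)) 2s≤b

  -- b is odd, so at most one of s and b ∸ s lies in the lower half
  ~-injective-half : ∀ {s t} → 2 * s ≤ b → 2 * t ≤ b → s ~ t → s ≡ t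
  ~-injective-half {s} {t} 2s≤b 2t≤b s~t with ~-below-b (2*≤b⇒<b 2s≤b) (2*≤b⇒<b 2t≤b) s~t
  ... | inj₁ s≡t   = s≡t
  ... | inj₂ s+t≡b = ⊥-elim (b≢2* s (≤-antisym (+-cancelʳ-≤ (2 * t) b (2 * s) b+2t≤2s+2t) 2s≤b))
    where
    open ≤-Reasoning
    b+2t≤2s+2t : b + 2 * t ≤ 2 * s + 2 * t
    b+2t≤2s+2t = begin
      b + 2 * t         ≤⟨ +-monoʳ-≤ b 2t≤b ⟩
      b + b             ≡⟨ cong (λ u → u + u) s+t≡b ⟨
      (s + t) + (s + t) ≡⟨ solve 2 (λ s t → (s :+ t) :+ (s :+ t) := con 2 :* s :+ con 2 :* t) refl s t ⟩
      2 * s + 2 * t     ∎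
      where open +-*-Solver

  ~-injective-odd : ∀ {s t} → Odd s → Odd t → s < b → t < b → s ~ t → s ≡ t
  ~-injective-odd {s} {t} s-odd t-odd s<b t<b s~t with ~-below-b s<b t<b s~t
  ... | inj₁ s≡t   = s≡t
  ... | inj₂ s+t≡b = ⊥-elim (¬even∧odd {b} (subst Even s+t≡b (odd+odd {s} {t} s-odd t-odd)) b-odd)

  2[b∸r]≤b : ∀ {r} → b < 2 * r → 2 * (b ∸ r) ≤ b
  2[b∸r]≤b {r} b<2r = begin
    2 * (b ∸ r)   ≡⟨ *-distribˡ-∸ 2 b r ⟩
    2 * b ∸ 2 * r ≤⟨ m≤n+o⇒m∸n≤o (2 * b) (2 * r) 2b≤2r+b ⟩
    b             ∎
    where
    open ≤-Reasoning
    2b≤2r+b : 2 * b ≤ 2 * r + b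
    2b≤2r+b = subst (_≤ 2 * r + b) (cong (b +_) (sym (+-identityʳ b))) (+-monoˡ-≤ b (<⇒≤ b<2r))

  modStar-spec : ∀ m → 2 * modStar b m ≤ b × modStar b m ~ m
  modStar-spec m with 2 * (m % b) ≤ᵇ b in fits
  ... | true  = ≤ᵇ⇒≤ (2 * (m % b)) b (subst T (sym fits) _) , plus (%-≋ m)
  ... | false = 2[b∸r]≤b {m % b} (≰⇒> λ 2r≤b → subst T fits (≤⇒≤ᵇ 2r≤b)) ,
                minus (≋-trans (+-≋ (≋-refl {b ∸ m % b}) (≋-sym (%-≋ m)))
                               (≋-trans (≋-reflexive (m∸n+n≡m (<⇒≤ (m%n<n m b)))) b≋0))

  modStar-≤ : ∀ m → 2 * modStar b m ≤ b
  modStar-≤ m = proj₁ (modStar-spec m)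

  modStar-~ : ∀ m → modStar b m ~ m
  modStar-~ m = proj₂ (modStar-spec m)

  modStar-unique : ∀ {s m} → 2 * s ≤ b → s ~ m → modStar b m ≡ s
  modStar-unique {s} {m} 2s≤b s~m = ~-injective-half (modStar-≤ m) 2s≤b (~-trans (modStar-~ m) (~-sym s~m))

  modStar-cong : ∀ {m m'} → m ~ m' → modStar b m ≡ modStar b m'
  modStar-cong {m} {m'} m~m' = sym (modStar-unique (modStar-≤ m) (~-trans (modStar-~ m) m~m'))

  -- RRS*(b) with the bound (b - 1)/2 replaced by the equivalent 2r ≤ b
  Reduced : ℕ → Set
  Reduced r = 1 ≤ r × 2 * r ≤ b × Coprime r b

  RRS*⇒Reduced : ∀ {r} → RRS* b r → Reduced r
  RRS*⇒Reduced {r} (1≤r , r≤n/2 , r⊥b) = 1≤r , ≤-trans (*-monoʳ-≤ 2 r≤n/2) 2[n/2]≤b , r⊥b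
    where
    2[n/2]≤b : 2 * (n / 2) ≤ b
    2[n/2]≤b = ≤-trans (subst (_≤ n) (*-comm (n / 2) 2) (m/n*n≤m n 2)) (n≤1+n n)

  Reduced⇒RRS* : ∀ {r} → Reduced r → RRS* b r
  Reduced⇒RRS* {r} (1≤r , 2r≤b , r⊥b) = 1≤r , r≤n/2 , r⊥b
    where
    2r≤n : 2 * r ≤ n
    2r≤n = s≤s⁻¹ (≤∧≢⇒< 2r≤b λ 2r≡b → b≢2* r (sym 2r≡b))
    r≤n/2 : r ≤ n / 2
    r≤n/2 = subst (_≤ n / 2) (trans (cong (_/ 2) (*-comm 2 r)) (m*n/n≡m r 2)) (/-monoˡ-≤ 2 2r≤n)

  Reduced⇒2*≤b : ∀ {r} → Reduced r → 2 * r ≤ b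
  Reduced⇒2*≤b = proj₁ ∘ proj₂

  Reduced⇒coprime : ∀ {r} → Reduced r → Coprime r b
  Reduced⇒coprime = proj₂ ∘ proj₂

  Reduced⇒<b : ∀ {r} → Reduced r → r < b
  Reduced⇒<b (_ , 2r≤b , _) = 2*≤b⇒<b 2r≤b

  modStar-Reduced : ∀ {m} → Coprime m b → Reduced (modStar b m)
  modStar-Reduced {m} m⊥b = coprime⇒1≤ r⊥b , modStar-≤ m , r⊥b
    where r⊥b = coprime-resp-~ (~-sym (modStar-~ m)) m⊥b

  Reduced-1 : Reduced 1
  Reduced-1 = ≤-refl , ≤-trans (n≤1+n 2) 3≤b , coprime-1

  Reduced-b∸ : ∀ {x} → x < b → Coprime x b → b < 2 * x → Reduced (b ∸ x)
  Reduced-b∸ {x} x<b x⊥b b<2x = m<n⇒0<n∸m x<b , 2[b∸r]≤b {x} b<2x , coprime-b∸ (<⇒≤ x<b) x⊥b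

  Reduced≢b∸Reduced : ∀ {x y} → Reduced x → Reduced y → x ≢ b ∸ y
  Reduced≢b∸Reduced {x} {y} (_ , 2x≤b , _) (_ , 2y≤b , _) x≡b∸y = b≢2* x (begin
    b       ≡⟨ x+y≡b ⟨
    x + y   ≡⟨ cong (x +_) x≡y ⟨
    x + x   ≡⟨ cong (x +_) (+-identityʳ x) ⟨
    2 * x   ∎)
    where
    open ≡-Reasoning
    x+y≡b : x + y ≡ b
    x+y≡b = trans (cong (_+ y) x≡b∸y) (m∸n+n≡m (≤-trans (m≤m+n y (y + 0)) 2y≤b))
    x≡y : x ≡ y
    x≡y = ~-injective-half 2x≤b 2y≤b (minus (≋-trans (≋-reflexive x+y≡b) b≋0))

  -- The sequences mod*(a 2^j, b) and their period

  seq-~ : ∀ a j → seq b a j ~ a * 2 ^ j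
  seq-~ a j = modStar-~ (a * 2 ^ j)

  seq-≡ : ∀ a j a' j' → a * 2 ^ j ~ a' * 2 ^ j' → seq b a j ≡ seq b a' j'
  seq-≡ a j a' j' = modStar-cong

  seq-≡⁻ : ∀ a j a' j' → seq b a j ≡ seq b a' j' → a * 2 ^ j ~ a' * 2 ^ j'
  seq-≡⁻ a j a' j' eq = ~-trans (~-sym (seq-~ a j)) (subst (_~ a' * 2 ^ j') (sym eq) (seq-~ a' j'))

  seq-0 : ∀ {a} → 2 * a ≤ b → seq b a 0 ≡ a
  seq-0 {a} 2a≤b = modStar-unique 2a≤b (~-reflexive (sym (*-identityʳ a)))

  *-2^-+ : ∀ a j t → a * 2 ^ j * 2 ^ t ≡ a * 2 ^ (j + t)
  *-2^-+ a j t = trans (*-assoc a (2 ^ j) (2 ^ t)) (cong (a *_) (sym (^-distribˡ-+-* 2 j t)))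

  seq-seq : ∀ a j t → seq b (seq b a j) t ≡ seq b a (j + t)
  seq-seq a j t = seq-≡ (seq b a j) t a (j + t) (~-trans (*-~ʳ (2 ^ t) (seq-~ a j)) (~-reflexive (*-2^-+ a j t)))

  seq-Reduced : ∀ {a} j → Coprime a b → Reduced (seq b a j)
  seq-Reduced {a} j a⊥b = modStar-Reduced (coprime-* a⊥b (coprime-2^ j))

  seq<b : ∀ {a} j → Coprime a b → seq b a j < b
  seq<b j a⊥b = Reduced⇒<b (seq-Reduced j a⊥b)

  oddPart-Reduced : ∀ {x} → Reduced x → Odd (oddPart x) × Reduced (oddPart x)
  oddPart-Reduced {x} (1≤x , 2x≤b , x⊥b) = o-odd , odd⇒1≤ o-odd , ≤-trans (*-monoʳ-≤ 2 o≤x) 2x≤b , o⊥b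
    where
    o = oddPart x
    x≡ = proj₁ (oddPart-spec x 1≤x)
    o-odd = proj₂ (oddPart-spec x 1≤x)
    o≤x : o ≤ x
    o≤x = subst (o ≤_) (sym x≡) (m≤n*m o (2 ^ v2 x) {{>-nonZero (m^n>0 2 (v2 x))}})
    o⊥b : Coprime o b
    o⊥b {d} (d∣o , d∣b) = x⊥b (subst (d ∣_) (sym x≡) (∣n⇒∣m*n (2 ^ v2 x) d∣o) , d∣b)

  seq-oddPart : ∀ {x} → Reduced x → seq b (oddPart x) (v2 x) ≡ x
  seq-oddPart {x} (1≤x , 2x≤b , _) =
    modStar-unique 2x≤b (~-reflexive (trans (proj₁ (oddPart-spec x 1≤x)) (*-comm (2 ^ v2 x) (oddPart x))))

  Pow2±1 : ℕ → Set
  Pow2±1 k = 2 ^ k ~ 1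

  Pow2±1⇒PlusMinusOne : ∀ k → Pow2±1 k → PlusMinusOne b k
  Pow2±1⇒PlusMinusOne k (plus (mk≋ p)) = inj₁ (trans p (m<n⇒m%n≡m 1<b))
  Pow2±1⇒PlusMinusOne k (minus q) = inj₂ (suc-injective (≤-antisym (m%n<n (2 ^ k) b) (∣⇒≤ b∣1+r)))
    where
    b∣1+r : b ∣ suc (2 ^ k % b)
    b∣1+r = ≋0⇒∣ (≋-trans (≋-reflexive (+-comm 1 (2 ^ k % b))) (≋-trans (+-≋ (%-≋ (2 ^ k)) (≋-refl {1})) q))

  PlusMinusOne⇒Pow2±1 : ∀ k → PlusMinusOne b k → Pow2±1 k
  PlusMinusOne⇒Pow2±1 k (inj₁ p) = plus (mk≋ (trans p (sym (m<n⇒m%n≡m 1<b))))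
  PlusMinusOne⇒Pow2±1 k (inj₂ p) = minus (≋-trans (+-≋ (≋-sym (%-≋ (2 ^ k))) (≋-refl {1}))
                                          (≋-trans (≋-reflexive (trans (cong (_+ 1) p) (+-comm n 1))) b≋0))

  seq-period⇒Pow2±1 : ∀ {a} t q → Coprime a b → seq b a (t + q) ≡ seq b a t → Pow2±1 q
  seq-period⇒Pow2±1 {a} t q a⊥b eq = *-cancelˡ-~ (coprime-* a⊥b (coprime-2^ t)) (begin
    a * 2 ^ t * 2 ^ q ≡⟨ *-2^-+ a t q ⟩
    a * 2 ^ (t + q)   ≈⟨ seq-≡⁻ a (t + q) a t eq ⟩
    a * 2 ^ t         ≡⟨ *-identityʳ (a * 2 ^ t) ⟨
    a * 2 ^ t * 1     ∎)
    where open ~-Reasoning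

  -- the n + 1 values seq b 1 0, …, seq b 1 n lie in [1, n], so two of them coincide
  Pow2±1-exists : ∃[ d ] (1 ≤ d × d < b × Pow2±1 d)
  Pow2±1-exists with pigeonhole (n<1+n n) (λ (i : Fin (suc n)) → fromℕ< (value< (toℕ i)))
    where
    value< : ∀ k → seq b 1 k ∸ 1 < n
    value< k = ∸-monoˡ-< (seq<b k coprime-1) (proj₁ (seq-Reduced k coprime-1))
  ... | i , j , i<j , same = d , m<n⇒0<n∸m i<j , s≤s (≤-trans (m∸n≤m (toℕ j) (toℕ i)) (≤-pred (toℕ<n j))) ,
                             seq-period⇒Pow2±1 (toℕ i) d coprime-1
                               (trans (cong (seq b 1) (m+[n∸m]≡n (<⇒≤ i<j))) (sym seq≡))
    where
    d = toℕ j ∸ toℕ i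
    seq≡ : seq b 1 (toℕ i) ≡ seq b 1 (toℕ j)
    seq≡ = ∸-cancelʳ-≡ (proj₁ (seq-Reduced (toℕ i) coprime-1)) (proj₁ (seq-Reduced (toℕ j) coprime-1))
                       (trans (sym (toℕ-fromℕ< _)) (trans (cong toℕ same) (toℕ-fromℕ< _)))

  abstract
    P-lowest : ∃[ P ] (P < b × IsLeastPos Pow2±1 P)
    P-lowest with Pow2±1-exists
    ... | d , 1≤d , d<b , 2^d~1 with IsLeastPos-lowest (λ k → 2 ^ k ~? 1) d 1≤d 2^d~1
    ...   | P , P≤d , least = P , ≤-<-trans P≤d d<b , least

  P : ℕ
  P = proj₁ P-lowest

  P<b : P < b
  P<b = proj₁ (proj₂ P-lowest)

  P-IsLeastPos : IsLeastPos Pow2±1 P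
  P-IsLeastPos = proj₂ (proj₂ P-lowest)

  1≤P : 1 ≤ P
  1≤P = proj₁ P-IsLeastPos

  P-minimal : ∀ m → 1 ≤ m → Pow2±1 m → P ≤ m
  P-minimal = proj₂ (proj₂ P-IsLeastPos)

  instance
    P-nonZero : NonZero P
    P-nonZero = >-nonZero 1≤P

  P-IsLeastPos-PlusMinusOne : IsLeastPos (PlusMinusOne b) P
  P-IsLeastPos-PlusMinusOne = IsLeastPos-resp (λ m _ → Pow2±1⇒PlusMinusOne m) (λ m _ → PlusMinusOne⇒Pow2±1 m) P-IsLeastPos

  seq-+-Pow2±1 : ∀ a t {q} → Pow2±1 q → seq b a (t + q) ≡ seq b a t
  seq-+-Pow2±1 a t {q} 2^q~1 = seq-≡ a (t + q) a t (begin
    a * 2 ^ (t + q)   ≡⟨ *-2^-+ a t q ⟨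
    a * 2 ^ t * 2 ^ q ≈⟨ *-~ˡ (a * 2 ^ t) 2^q~1 ⟩
    a * 2 ^ t * 1     ≡⟨ *-identityʳ (a * 2 ^ t) ⟩
    a * 2 ^ t         ∎)
    where open ~-Reasoning

  seq-+P : ∀ a t → seq b a (t + P) ≡ seq b a t
  seq-+P a t = seq-+-Pow2±1 a t (proj₁ (proj₂ P-IsLeastPos))

  seq-+*P : ∀ a t k → seq b a (t + k * P) ≡ seq b a t
  seq-+*P a t zero    = cong (seq b a) (+-identityʳ t)
  seq-+*P a t (suc k) = begin
    seq b a (t + (P + k * P)) ≡⟨ cong (seq b a) (solve 3 (λ t P kP → t :+ (P :+ kP) := t :+ kP :+ P) refl t P (k * P)) ⟩
    seq b a (t + k * P + P)   ≡⟨ seq-+P a (t + k * P) ⟩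
    seq b a (t + k * P)       ≡⟨ seq-+*P a t k ⟩
    seq b a t                 ∎
    where
    open ≡-Reasoning
    open +-*-Solver

  seq-%P : ∀ a u → seq b a u ≡ seq b a (u % P)
  seq-%P a u = trans (cong (seq b a) (m≡m%n+[m/n]*n u P)) (seq-+*P a (u % P) (u / P))

  seq-P : ∀ {a} → 2 * a ≤ b → seq b a P ≡ a
  seq-P {a} 2a≤b = trans (seq-+P a 0) (seq-0 2a≤b)

  P-IsPrimPeriod : ∀ a → OddRRS b a → IsPrimPeriod b a P
  P-IsPrimPeriod a (_ , _ , _ , a⊥b) = (1≤P , λ j _ → seq-+P a j) ,
    λ q (1≤q , periodic) → P-minimal q 1≤q (seq-period⇒Pow2±1 1 q a⊥b (periodic 1 ≤-refl))

  seq-injective-window : ∀ {a j j'} → Coprime a b → j < j' → j' < j + P → seq b a j ≢ seq b a j'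
  seq-injective-window {a} {j} {j'} a⊥b j<j' j'<j+P eq = <⇒≱ d<P (P-minimal d (m<n⇒0<n∸m j<j') 2^d~1)
    where
    d = j' ∸ j
    2^d~1 : Pow2±1 d
    2^d~1 = seq-period⇒Pow2±1 j d a⊥b (trans (cong (seq b a) (m+[n∸m]≡n (<⇒≤ j<j'))) (sym eq))
    d<P : d < P
    d<P = subst (d <_) (m+n∸m≡n j P) (∸-monoˡ-< j'<j+P (<⇒≤ j<j'))

  seq-injective-period : ∀ {q r r'} → Coprime q b → r < P → r' < P → seq b q (suc r) ≡ seq b q (suc r') → r ≡ r'
  seq-injective-period {q} {r} {r'} q⊥b r<P r'<P same with <-cmp r r'
  ... | tri< r<r' _ _ = ⊥-elim (seq-injective-window q⊥b (s≤s r<r') (s≤s (≤-trans r'<P (m≤n+m P r))) same)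
  ... | tri≈ _ r≡r' _ = r≡r'
  ... | tri> _ _ r'<r = ⊥-elim (seq-injective-window q⊥b (s≤s r'<r) (s≤s (≤-trans r<P (m≤n+m P r'))) (sym same))

  seq-window : ∀ a v → ∃[ j ] (1 ≤ j × j ≤ P × seq b a v ≡ seq b a j)
  seq-window a v with v % P in v%P
  ... | zero  = P , 1≤P , ≤-refl , trans (seq-%P a v) (trans (cong (seq b a) v%P) (sym (seq-+P a 0)))
  ... | suc r = suc r , s≤s z≤n , subst (_≤ P) v%P (<⇒≤ (m%n<n v P)) , trans (seq-%P a v) (cong (seq b a) v%P)

  seq-return : ∀ {q} → 2 * q ≤ b → ∀ u → seq b (seq b q u) (P ∸ u % P) ≡ q
  seq-return {q} 2q≤b u = begin
    seq b (seq b q u) (P ∸ u % P)        ≡⟨ cong (λ x → seq b x (P ∸ u % P)) (seq-%P q u) ⟩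
    seq b (seq b q (u % P)) (P ∸ u % P)  ≡⟨ seq-seq q (u % P) (P ∸ u % P) ⟩
    seq b q (u % P + (P ∸ u % P))        ≡⟨ cong (seq b q) (m+[n∸m]≡n (<⇒≤ (m%n<n u P))) ⟩
    seq b q P                            ≡⟨ seq-P 2q≤b ⟩
    q                                    ∎
    where open ≡-Reasoning

  -- Coaches

  κ : ℕ → ℕ
  κ x = v2 (b ∸ x)

  coachStep-spec : ∀ {x} → Odd x → x < b → b ∸ x ≡ 2 ^ κ x * coachStep b x × Odd (coachStep b x) × 1 ≤ κ x
  coachStep-spec {x} x-odd x<b = w≡ , z-odd , 1≤κ
    where
    w = b ∸ x
    w≡ = proj₁ (oddPart-spec w (m<n⇒0<n∸m x<b))
    z-odd = proj₂ (oddPart-spec w (m<n⇒0<n∸m x<b))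
    w-even : Even w
    w-even = odd-+-odd⇒even {x} {w} (subst Odd (sym (m+[n∸m]≡n (<⇒≤ x<b))) b-odd) x-odd
    1≤κ : 1 ≤ κ x
    1≤κ with κ x in κ≡
    ... | suc _ = s≤s z≤n
    ... | zero  = ⊥-elim (¬even∧odd {w} w-even (subst Odd (sym w≡z) z-odd))
      where
      w≡z : w ≡ oddPart w
      w≡z = trans w≡ (trans (cong (λ e → 2 ^ e * oddPart w) κ≡) (+-identityʳ (oddPart w)))

  coachStep-odd : ∀ {x} → Odd x → x < b → Odd (coachStep b x)
  coachStep-odd x-odd x<b = proj₁ (proj₂ (coachStep-spec x-odd x<b))

  coachStep-~ : ∀ {x} → Odd x → x < b → 2 ^ κ x * coachStep b x ~ x
  coachStep-~ {x} x-odd x<b = minus (subst (λ w → w + x ≋ 0) (proj₁ (coachStep-spec x-odd x<b))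
                                           (≋-trans (≋-reflexive (m∸n+n≡m (<⇒≤ x<b))) b≋0))

  2^κ*coachStep≤b : ∀ {x} → Odd x → x < b → 2 ^ κ x * coachStep b x ≤ b
  2^κ*coachStep≤b {x} x-odd x<b = subst (_≤ b) (proj₁ (coachStep-spec x-odd x<b)) (m∸n≤m b x)

  coachStep-seq : ∀ {y t} → Odd y → Reduced y → 1 ≤ t → Odd (seq b y t) →
                  κ (seq b y t) ≤ t × coachStep b (seq b y t) ≡ seq b y (t ∸ κ (seq b y t))
  coachStep-seq {y} {t} y-odd (_ , 2y≤b , y⊥b) 1≤t x-odd = κ≤t , z≡
    where
    x = seq b y t
    x<b = Reduced⇒<b (seq-Reduced t y⊥b)
    k = κ x
    z = coachStep b x
    1≤k = proj₂ (proj₂ (coachStep-spec x-odd x<b))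
    2^kz~y2^t : 2 ^ k * z ~ y * 2 ^ t
    2^kz~y2^t = ~-trans (coachStep-~ x-odd x<b) (seq-~ y t)
    κ≤t : k ≤ t
    κ≤t with k ≤? t
    ... | yes k≤t = k≤t
    ... | no k≰t = ⊥-elim (¬even∧odd {y} (subst Even v≡y v-even) y-odd)
      where
      d = k ∸ t
      t+d≡k = m+[n∸m]≡n (<⇒≤ (≰⇒> k≰t))
      v = 2 ^ d * z
      v~y : v ~ y
      v~y = *-cancelˡ-~-2^ t (subst₂ _~_ (trans (cong (λ e → 2 ^ e * z) (sym t+d≡k))
                                                (trans (cong (_* z) (^-distribˡ-+-* 2 t d)) (*-assoc (2 ^ t) (2 ^ d) z)))
                                         (*-comm y (2 ^ t)) 2^kz~y2^t)
      2v≤b : 2 * v ≤ b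
      2v≤b = subst (_≤ b) (*-assoc 2 (2 ^ d) z)
               (≤-trans (*-monoˡ-≤ z (^-monoʳ-≤ 2 1+d≤k)) (2^κ*coachStep≤b x-odd x<b))
        where
        1+d≤k : suc d ≤ k
        1+d≤k = subst (suc d ≤_) t+d≡k (+-monoˡ-≤ d 1≤t)
      v≡y : v ≡ y
      v≡y = ~-injective-half 2v≤b 2y≤b v~y
      v-even : Even v
      v-even = subst (λ e → Even (2 ^ e * z)) (trans (+-comm 1 (d ∸ 1)) (m∸n+n≡m (m<n⇒0<n∸m (≰⇒> k≰t))))
                     (even-2^suc* (d ∸ 1) z)
    z≡ : z ≡ seq b y (t ∸ k)
    z≡ = sym (modStar-unique 2z≤b (*-cancelˡ-~-2^ k (~-trans 2^kz~y2^t (~-reflexive y2^t≡))))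
      where
      2z≤b : 2 * z ≤ b
      2z≤b = ≤-trans (*-monoˡ-≤ z (2≤2^ 1≤k)) (2^κ*coachStep≤b x-odd x<b)
      y2^t≡ : y * 2 ^ t ≡ 2 ^ k * (y * 2 ^ (t ∸ k))
      y2^t≡ = begin
        y * 2 ^ t                 ≡⟨ cong (λ e → y * 2 ^ e) (m+[n∸m]≡n κ≤t) ⟨
        y * 2 ^ (k + (t ∸ k))     ≡⟨ *-2^-+ y k (t ∸ k) ⟨
        y * 2 ^ k * 2 ^ (t ∸ k)   ≡⟨ cong (_* 2 ^ (t ∸ k)) (*-comm y (2 ^ k)) ⟩
        2 ^ k * y * 2 ^ (t ∸ k)   ≡⟨ *-assoc (2 ^ k) y (2 ^ (t ∸ k)) ⟩
        2 ^ k * (y * 2 ^ (t ∸ k)) ∎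
        where open ≡-Reasoning

  coach-in-orbit : ∀ {q} → Odd q → Reduced q → ∀ m →
                   ∃[ t ] (iter (coachStep b) m q ≡ seq b q t × Odd (iter (coachStep b) m q))
  coach-in-orbit q-odd (_ , 2q≤b , _) zero = 0 , sym (seq-0 2q≤b) , q-odd
  coach-in-orbit {q} q-odd q-red@(_ , _ , q⊥b) (suc m) with coach-in-orbit q-odd q-red m
  ... | t , c≡ , c-odd = t + P ∸ κ (seq b q (t + P)) , trans (cong (coachStep b) c≡′) step ,
                         coachStep-odd c-odd (subst (_< b) (sym c≡) (seq<b t q⊥b))
    where
    c≡′ : iter (coachStep b) m q ≡ seq b q (t + P)
    c≡′ = trans c≡ (sym (seq-+P q t))
    step = proj₂ (coachStep-seq q-odd q-red (≤-trans 1≤P (m≤n+m P t)) (subst Odd c≡′ c-odd))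

  coach-reaches : ∀ {y} → Odd y → Reduced y → ∀ t → Odd (seq b y t) →
                  ∃[ m ] (m ≤ t × iter (coachStep b) m (seq b y t) ≡ y)
  coach-reaches {y} y-odd y-red@(_ , 2y≤b , y⊥b) = <-rec _ reach
    where
    reach : ∀ t → (∀ {t'} → t' < t → Odd (seq b y t') → ∃[ m ] (m ≤ t' × iter (coachStep b) m (seq b y t') ≡ y)) →
            Odd (seq b y t) → ∃[ m ] (m ≤ t × iter (coachStep b) m (seq b y t) ≡ y)
    reach zero    _     _     = 0 , z≤n , seq-0 2y≤b
    reach (suc t) below x-odd =
      let m , m≤t′ , reached = below t′<1+t (subst Odd step x′-odd)
      in suc m , s≤s (≤-trans m≤t′ (≤-pred t′<1+t)) ,
         trans (iter-suc′ (coachStep b) m x) (trans (cong (iter (coachStep b) m) step) reached)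
      where
      x = seq b y (suc t)
      x<b = seq<b (suc t) y⊥b
      descent = coachStep-seq y-odd y-red (s≤s z≤n) x-odd
      step = proj₂ descent
      t′<1+t = ∸-monoʳ-< (proj₂ (proj₂ (coachStep-spec x-odd x<b))) (proj₁ descent)
      x′-odd = coachStep-odd x-odd x<b

  a₁ : ℕ → ℕ
  a₁ m = iter (coachStep b) m 1

  K : ℕ → ℕ
  K = Sum (κ ∘ a₁)

  a₁-odd : ∀ m → Odd (a₁ m)
  a₁-odd m = proj₂ (proj₂ (coach-in-orbit refl Reduced-1 m))

  a₁<b : ∀ m → a₁ m < b
  a₁<b m = let t , a₁m≡ , _ = coach-in-orbit refl Reduced-1 m in subst (_< b) (sym a₁m≡) (seq<b t coprime-1)

  m≤K : ∀ m → m ≤ K m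
  m≤K zero    = z≤n
  m≤K (suc m) = subst (_≤ K m + κ (a₁ m)) (+-comm m 1)
                      (+-mono-≤ (m≤K m) (proj₂ (proj₂ (coachStep-spec (a₁-odd m) (a₁<b m)))))

  seq-1-0 : seq b 1 0 ≡ 1
  seq-1-0 = seq-0 (Reduced⇒2*≤b Reduced-1)

  -- Read backwards along (seq b 1), the coach with input 1 walks from position P down to position 0.
  coach₁-step : ∀ m → K m < P → a₁ m ≡ seq b 1 (P ∸ K m) →
                K (suc m) ≤ P × a₁ (suc m) ≡ seq b 1 (P ∸ K (suc m))
  coach₁-step m Km<P a₁m≡ = K+κ≤P , trans (cong (coachStep b) a₁m≡) (trans step (cong (seq b 1) P∸K∸κ≡))
    where
    t = P ∸ K m
    t-odd = subst Odd a₁m≡ (a₁-odd m)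
    κ≡ : κ (a₁ m) ≡ κ (seq b 1 t)
    κ≡ = cong κ a₁m≡
    descent = coachStep-seq refl Reduced-1 (m<n⇒0<n∸m Km<P) t-odd
    step = proj₂ descent
    K+κ≤P : K m + κ (a₁ m) ≤ P
    K+κ≤P = subst (K m + κ (a₁ m) ≤_) (m+[n∸m]≡n (<⇒≤ Km<P))
                  (+-monoʳ-≤ (K m) (subst (_≤ t) (sym κ≡) (proj₁ descent)))
    P∸K∸κ≡ : t ∸ κ (seq b 1 t) ≡ P ∸ K (suc m)
    P∸K∸κ≡ = trans (∸-+-assoc P (K m) _) (cong (λ k → P ∸ (K m + k)) (sym κ≡))

  seq-1-P∸ : ∀ {k} → k ≡ P → seq b 1 (P ∸ k) ≡ 1
  seq-1-P∸ refl = trans (cong (seq b 1) (n∸n≡0 P)) seq-1-0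

  seq-1-P∸≡1⇒ : ∀ {k} → 1 ≤ k → k ≤ P → seq b 1 (P ∸ k) ≡ 1 → k ≡ P
  seq-1-P∸≡1⇒ {k} 1≤k k≤P returned with m≤n⇒m<n∨m≡n k≤P
  ... | inj₂ k≡P = k≡P
  ... | inj₁ k<P = ⊥-elim (<⇒≱ (∸-monoʳ-< 1≤k k≤P) (P-minimal (P ∸ k) (m<n⇒0<n∸m k<P) 2^[P∸k]~1))
    where
    2^[P∸k]~1 : Pow2±1 (P ∸ k)
    2^[P∸k]~1 = seq-period⇒Pow2±1 0 (P ∸ k) coprime-1 (trans returned (sym seq-1-0))

  coach₁-position : ∀ m → (∀ m' → 1 ≤ m' → m' ≤ m → a₁ m' ≢ 1) → K m < P × a₁ m ≡ seq b 1 (P ∸ K m)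
  coach₁-position zero    _         = 1≤P , sym (seq-P (Reduced⇒2*≤b Reduced-1))
  coach₁-position (suc m) no-return =
    ≤∧≢⇒< K≤P (λ K≡P → no-return (suc m) (s≤s z≤n) ≤-refl (trans a₁≡ (seq-1-P∸ K≡P))) , a₁≡
    where
    previous = coach₁-position m λ m' 1≤m' m'≤m → no-return m' 1≤m' (m≤n⇒m≤1+n m'≤m)
    next = coach₁-step m (proj₁ previous) (proj₂ previous)
    K≤P = proj₁ next
    a₁≡ = proj₂ next

  coach₁ : ∃[ r ] (CoachLength b 1 r × coachK b 1 r ≡ P)
  coach₁ with anyUpTo? (λ m → 1 ≤? m ×-dec a₁ m ≟ 1) (suc P)
  ... | no none = ⊥-elim (<⇒≱ (proj₁ (coach₁-position P never)) (m≤K P))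
    where
    never : ∀ m → 1 ≤ m → m ≤ P → a₁ m ≢ 1
    never m 1≤m m≤P a₁m≡1 = none (m , s≤s m≤P , 1≤m , a₁m≡1)
  ... | yes (m , _ , 1≤m , a₁m≡1) with IsLeastPos-lowest (λ m → a₁ m ≟ 1) m 1≤m a₁m≡1
  ...   | suc r′ , _ , least@(_ , a₁r≡1 , minimal) = suc r′ , least , trans (sum-map-upTo (κ ∘ a₁) (suc r′)) K≡P
    where
    no-return : ∀ m' → 1 ≤ m' → m' ≤ r′ → a₁ m' ≢ 1
    no-return m' 1≤m' m'≤r′ a₁m'≡1 = <⇒≱ (s≤s m'≤r′) (minimal m' 1≤m' a₁m'≡1)
    position = coach₁-position r′ no-return
    final = coach₁-step r′ (proj₁ position) (proj₂ position)
    K≡P : K (suc r′) ≡ P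
    K≡P = seq-1-P∸≡1⇒ (≤-trans (s≤s z≤n) (m≤K (suc r′))) (proj₁ final) (trans (sym (proj₂ final)) a₁r≡1)

  -- Schick cycles

  schick-step : ∀ {w} → Odd w → w < b → Odd (schick b w) × schick b w < b × schick b w ~ 2 * w
  schick-step {w} w-odd w<b with 2 * w ≤? b
  ... | yes 2w≤b = odd , <b ,
                   minus (subst (λ s → s + 2 * w ≋ 0) (sym s≡) (≋-trans (≋-reflexive (m∸n+n≡m 2w≤b)) b≋0))
    where
    s≡ : schick b w ≡ b ∸ 2 * w
    s≡ = m≤n⇒∣n-m∣≡n∸m 2w≤b
    odd = subst Odd (sym s≡) (odd-+-even⇒odd {2 * w} (subst Odd (sym (m+[n∸m]≡n 2w≤b)) b-odd) (even-2* w))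
    <b = subst (_< b) (sym s≡) (∸-monoʳ-< (≤-trans (odd⇒1≤ w-odd) (m≤m+n w (w + 0))) 2w≤b)
  ... | no 2w≰b = odd , <b , plus (≋-trans (≋-sym (+-≋0 b≋0)) (≋-reflexive s+b≡))
    where
    b<2w = ≰⇒> 2w≰b
    s≡ : schick b w ≡ 2 * w ∸ b
    s≡ = m≤n⇒∣m-n∣≡n∸m (<⇒≤ b<2w)
    s+b≡ : schick b w + b ≡ 2 * w
    s+b≡ = trans (cong (_+ b) s≡) (m∸n+n≡m (<⇒≤ b<2w))
    odd = even-+-odd⇒odd {b} {schick b w} (subst Even (trans (sym s+b≡) (+-comm (schick b w) b)) (even-2* w)) b-odd
    <b = subst (_< b) (sym s≡) (subst (2 * w ∸ b <_) (trans (m+n∸m≡n b (b + 0)) (+-identityʳ b))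
                                      (∸-monoˡ-< (*-monoʳ-< 2 w<b) (<⇒≤ b<2w)))

  schick-iter : ∀ {q} → Odd q → q < b → ∀ m →
                Odd (iter (schick b) m q) × iter (schick b) m q < b × iter (schick b) m q ~ q * 2 ^ m
  schick-iter {q} q-odd q<b zero    = q-odd , q<b , ~-reflexive (sym (*-identityʳ q))
  schick-iter {q} q-odd q<b (suc m) with schick-iter q-odd q<b m
  ... | w-odd , w<b , w~ with schick-step w-odd w<b
  ...   | s-odd , s<b , s~ = s-odd , s<b , ~-trans s~ (~-trans (*-~ˡ 2 w~) (~-reflexive (*-comm-2 q (2 ^ m))))
    where
    *-comm-2 : ∀ q x → 2 * (q * x) ≡ q * (2 * x)
    *-comm-2 q x = solve 2 (λ q x → con 2 :* (q :* x) := q :* (con 2 :* x)) refl q x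
      where open +-*-Solver

  schick-return⇔Pow2±1 : ∀ m → iter (schick b) m 1 ≡ 1 ⇔ Pow2±1 m
  schick-return⇔Pow2±1 m = mk⇔
    (λ returns → ~-trans (~-reflexive (sym (*-identityˡ (2 ^ m)))) (~-trans (~-sym w~) (~-reflexive returns)))
    (λ 2^m~1 → ~-injective-odd w-odd refl w<b 1<b (~-trans w~ (~-trans (~-reflexive (*-identityˡ (2 ^ m))) 2^m~1)))
    where
    w-odd = proj₁ (schick-iter refl 1<b m)
    w<b = proj₁ (proj₂ (schick-iter refl 1<b m))
    w~ = proj₂ (proj₂ (schick-iter refl 1<b m))

  P-IsPes : IsPes b P
  P-IsPes = IsLeastPos-resp (λ m _ → Equivalence.from (schick-return⇔Pow2±1 m))
                            (λ m _ → Equivalence.to (schick-return⇔Pow2±1 m)) P-IsLeastPos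

  OrbitMin : ℕ → Set
  OrbitMin q = Odd q × Reduced q × (∀ u → Odd (seq b q u) → q ≤ seq b q u)

  OrbitMin-≤ : ∀ {q} → OrbitMin q → ∀ u → Odd (seq b q u) → q ≤ seq b q u
  OrbitMin-≤ = proj₂ ∘ proj₂

  OrbitMin-1 : OrbitMin 1
  OrbitMin-1 = refl , Reduced-1 , λ u → odd⇒1≤

  OrbitMin-unique : ∀ {q q'} → OrbitMin q → OrbitMin q' → ∀ u → seq b q u ≡ q' → q ≡ q'
  OrbitMin-unique {q} {q'} (q-odd , (_ , 2q≤b , _) , q-min) (q'-odd , _ , q'-min) u q→q' =
    ≤-antisym (subst (q ≤_) q→q' (q-min u (subst Odd (sym q→q') q'-odd)))
              (subst (q' ≤_) q'→q (q'-min t (subst Odd (sym q'→q) q-odd)))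
    where
    t = P ∸ u % P
    q'→q : seq b q' t ≡ q
    q'→q = trans (cong (λ x → seq b x t) (sym q→q')) (seq-return 2q≤b u)

  FromOrbitMin : ℕ → Set
  FromOrbitMin x = ∃[ m ] (OrbitMin m × ∃[ u ] (1 ≤ u × seq b m u ≡ x))

  OrbitMin-below : ∀ {x} → Odd x → Reduced x → FromOrbitMin x
  OrbitMin-below {x} = <-rec (λ x → Odd x → Reduced x → FromOrbitMin x) descend x
    where
    descend : ∀ x → (∀ {y} → y < x → Odd y → Reduced y → FromOrbitMin y) → Odd x → Reduced x → FromOrbitMin x
    descend x below x-odd x-red@(_ , 2x≤b , x⊥b) with anyUpTo? (λ u → (seq b x u % 2 ≟ 1) ×-dec (seq b x u <? x)) P
    ... | no none = x , (x-odd , x-red , x-min) , P , 1≤P , seq-P 2x≤b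
      where
      x-min : ∀ u → Odd (seq b x u) → x ≤ seq b x u
      x-min u y-odd = ≮⇒≥ λ y<x →
        none (u % P , m%n<n u P , subst Odd (seq-%P x u) y-odd , subst (_< x) (seq-%P x u) y<x)
    ... | yes (u , _ , y-odd , y<x) with below y<x y-odd (seq-Reduced u x⊥b)
    ...   | m , m-min , v , 1≤v , m→y = m , m-min , v + t , ≤-trans 1≤v (m≤m+n v t) , m→x
      where
      t = P ∸ u % P
      m→x : seq b m (v + t) ≡ x
      m→x = trans (sym (seq-seq m v t)) (trans (cong (λ y → seq b y t) m→y) (seq-return 2x≤b u))

  OrbitMin⇒coachMin : ∀ {q} → OrbitMin q → ∀ m → q ≤ iter (coachStep b) m q
  OrbitMin⇒coachMin (q-odd , q-red , q-min) m with coach-in-orbit q-odd q-red m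
  ... | t , c≡ , c-odd = subst (_ ≤_) (sym c≡) (q-min t (subst Odd c≡ c-odd))

  coachMin⇒OrbitMin : ∀ {q} → Odd q → Reduced q → (∀ m → m < b → q ≤ iter (coachStep b) m q) → OrbitMin q
  coachMin⇒OrbitMin {q} q-odd q-red@(_ , 2q≤b , q⊥b) coach-min = q-odd , q-red , q-min
    where
    q-min : ∀ u → Odd (seq b q u) → q ≤ seq b q u
    q-min u y-odd = subst (q ≤_) reached (coach-min m (≤-<-trans (≤-trans m≤t (m∸n≤m P (u % P))) P<b))
      where
      t = P ∸ u % P
      back = seq-return 2q≤b u
      reaches = coach-reaches y-odd (seq-Reduced u q⊥b) t (subst Odd (sym back) q-odd)
      m = proj₁ reaches
      m≤t = proj₁ (proj₂ reaches)
      reached : iter (coachStep b) m q ≡ seq b q u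
      reached = trans (cong (iter (coachStep b) m) (sym back)) (proj₂ (proj₂ reaches))

  OrbitMin⇒schickMin : ∀ {q} → OrbitMin q → ∀ m → q ≤ iter (schick b) m q
  OrbitMin⇒schickMin {q} (q-odd , q-red@(_ , 2q≤b , _) , q-min) m with schick-iter q-odd (Reduced⇒<b q-red) m
  ... | w-odd , _ , w~ with 2 * iter (schick b) m q ≤? b
  ...   | yes 2w≤b = subst (q ≤_) w≡ (q-min m (subst Odd (sym w≡) w-odd))
    where
    w≡ : seq b q m ≡ iter (schick b) m q
    w≡ = modStar-unique 2w≤b w~
  ...   | no 2w≰b = <⇒≤ (*-cancelˡ-< 2 q _ (≤-<-trans 2q≤b (≰⇒> 2w≰b)))

  schickMin⇒OrbitMin : ∀ {q} → Odd q → 1 ≤ q → q < b → Coprime q b →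
                       (∀ m → m < b → q ≤ iter (schick b) m q) → OrbitMin q
  schickMin⇒OrbitMin {q} q-odd 1≤q q<b q⊥b schick-min = q-odd , q-red , q-min
    where
    2q≤b : 2 * q ≤ b
    2q≤b with 2 * q ≤? b
    ... | yes 2q≤b = 2q≤b
    ... | no 2q≰b = ⊥-elim (<⇒≱ q<b (+-cancelʳ-≤ q b q b+q≤q+q))
      where
      b<2q = ≰⇒> 2q≰b
      q≤2q∸b : q ≤ 2 * q ∸ b
      q≤2q∸b = subst (q ≤_) (m≤n⇒∣m-n∣≡n∸m (<⇒≤ b<2q)) (schick-min 1 1<b)
      b+q≤q+q : b + q ≤ q + q
      b+q≤q+q = subst (b + q ≤_) (trans (m+[n∸m]≡n (<⇒≤ b<2q)) (cong (q +_) (+-identityʳ q))) (+-monoʳ-≤ b q≤2q∸b)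
    q-red : Reduced q
    q-red = 1≤q , 2q≤b , q⊥b
    q-min : ∀ u → Odd (seq b q u) → q ≤ seq b q u
    q-min u y-odd with schick-iter q-odd q<b (u % P)
    ... | w-odd , w<b , w~ = subst (q ≤_) w≡y (schick-min (u % P) (<-trans (m%n<n u P) P<b))
      where
      y~ : seq b q u ~ q * 2 ^ (u % P)
      y~ = subst (_~ q * 2 ^ (u % P)) (sym (seq-%P q u)) (seq-~ q (u % P))
      w≡y : iter (schick b) (u % P) q ≡ seq b q u
      w≡y = ~-injective-odd w-odd y-odd w<b (seq<b u q⊥b) (~-trans w~ (~-sym y~))

  coachLeaderᵇ : ℕ → Bool
  coachLeaderᵇ q = oddᵇ q ∧ rrsᵇ b q ∧ cycleMinᵇ (coachStep b) b q

  schickLeaderᵇ : ℕ → Bool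
  schickLeaderᵇ q = Oᵇ b q ∧ cycleMinᵇ (schick b) b q

  T-coachLeaderᵇ : ∀ q → T (coachLeaderᵇ q) ⇔ OrbitMin q
  T-coachLeaderᵇ q = mk⇔ to from
    where
    to : T (coachLeaderᵇ q) → OrbitMin q
    to t = let t₁ , t₂₃ = Equivalence.to T-∧ t ; t₂ , t₃ = Equivalence.to T-∧ t₂₃
           in coachMin⇒OrbitMin (Equivalence.to (T-oddᵇ q) t₁) (RRS*⇒Reduced (Equivalence.to (T-rrsᵇ b q) t₂))
                                (Equivalence.to (T-cycleMinᵇ (coachStep b) b q) t₃)
    from : OrbitMin q → T (coachLeaderᵇ q)
    from q-min@(q-odd , q-red , _) =
      Equivalence.from T-∧ (Equivalence.from (T-oddᵇ q) q-odd , Equivalence.from T-∧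
        (Equivalence.from (T-rrsᵇ b q) (Reduced⇒RRS* q-red) ,
         Equivalence.from (T-cycleMinᵇ (coachStep b) b q) λ m _ → OrbitMin⇒coachMin q-min m))

  T-schickLeaderᵇ : ∀ q → T (schickLeaderᵇ q) ⇔ OrbitMin q
  T-schickLeaderᵇ q = mk⇔ to from
    where
    to : T (schickLeaderᵇ q) → OrbitMin q
    to t = let tO , tc = Equivalence.to T-∧ t ; t₁ , t₂₃₄ = Equivalence.to T-∧ tO
               t₂ , t₃₄ = Equivalence.to T-∧ t₂₃₄ ; t₃ , t₄ = Equivalence.to T-∧ t₃₄
           in schickMin⇒OrbitMin (Equivalence.to (T-oddᵇ q) t₁) (≤ᵇ⇒≤ 1 q t₂) (<ᵇ⇒< q b t₃) (toWitness t₄)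
                                 (Equivalence.to (T-cycleMinᵇ (schick b) b q) tc)
    from : OrbitMin q → T (schickLeaderᵇ q)
    from q-min@(q-odd , q-red@(1≤q , _ , q⊥b) , _) =
      Equivalence.from T-∧ (Equivalence.from T-∧ (Equivalence.from (T-oddᵇ q) q-odd , Equivalence.from T-∧ (≤⇒≤ᵇ 1≤q ,
        Equivalence.from T-∧ (<⇒<ᵇ (Reduced⇒<b q-red) , fromWitness (λ {d} → q⊥b {d})))) ,
        Equivalence.from (T-cycleMinᵇ (schick b) b q) λ m _ → OrbitMin⇒schickMin q-min m)

  Occurs-return : ∀ {p q} → 2 * q ≤ b → ∀ u → Occurs b p (seq b q u) → Occurs b p q
  Occurs-return {p} {q} 2q≤b u (j , 1≤j , p→y) = j + t , ≤-trans 1≤j (m≤m+n j t) ,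
    trans (sym (seq-seq p j t)) (trans (cong (λ y → seq b y t) p→y) (seq-return 2q≤b u))
    where t = P ∸ u % P

  -- MDS systems

  module MDS (c : ℕ) (a : ℕ → ℕ) (inputs : IsMDSInputs b c a) where

    next : ∀ i → 1 ≤ i → i < c → OddRRS b (a (suc i)) × ¬ OccursBefore b a i (a (suc i)) ×
                                 (∀ x → OddRRS b x → ¬ OccursBefore b a i x → a (suc i) ≤ x)
    next = proj₁ (proj₂ (proj₂ inputs))

    covered : ∀ x → OddRRS b x → OccursBefore b a c x
    covered = proj₂ (proj₂ (proj₂ inputs))

    input-OrbitMin : ∀ i → 1 ≤ i → i ≤ c → OrbitMin (a i)
    input-OrbitMin 1 _ _ = subst OrbitMin (sym (proj₁ (proj₂ inputs))) OrbitMin-1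
    input-OrbitMin (suc i@(suc _)) _ i<c with next i (s≤s z≤n) i<c
    ... | (q-odd , q-rrs) , fresh , least = q-odd , q-red , q-min
      where
      q = a (suc i)
      q-red = RRS*⇒Reduced q-rrs
      q-min : ∀ u → Odd (seq b q u) → q ≤ seq b q u
      q-min u y-odd = least (seq b q u) (y-odd , Reduced⇒RRS* (seq-Reduced u (Reduced⇒coprime q-red)))
        λ (l , 1≤l , l≤i , occ) → fresh (l , 1≤l , l≤i , Occurs-return {a l} (Reduced⇒2*≤b q-red) u occ)

    input-Reduced : ∀ i → 1 ≤ i → i ≤ c → Reduced (a i)
    input-Reduced i 1≤i i≤c = proj₁ (proj₂ (input-OrbitMin i 1≤i i≤c))

    last-entry : ∀ i → 1 ≤ i → i ≤ c → seq b (a i) P ≡ a i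
    last-entry i 1≤i i≤c = seq-P (Reduced⇒2*≤b (input-Reduced i 1≤i i≤c))

    input-fresh : ∀ i i' → 1 ≤ i → i < i' → i' ≤ c → a i ≢ a i'
    input-fresh i (suc i') 1≤i i<1+i' 1+i'≤c ai≡ai' with next i' (≤-trans 1≤i (≤-pred i<1+i')) 1+i'≤c
    ... | _ , fresh , _ = fresh (i , 1≤i , ≤-pred i<1+i' , P , 1≤P ,
                                 trans (last-entry i 1≤i (≤-trans (<⇒≤ i<1+i') 1+i'≤c)) ai≡ai')

    input-injective : ∀ i i' → 1 ≤ i → i ≤ c → 1 ≤ i' → i' ≤ c → a i ≡ a i' → i ≡ i'
    input-injective i i' 1≤i i≤c 1≤i' i'≤c ai≡ai' with <-cmp i i'
    ... | tri< i<i' _ _ = ⊥-elim (input-fresh i i' 1≤i i<i' i'≤c ai≡ai')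
    ... | tri≈ _ i≡i' _ = i≡i'
    ... | tri> _ _ i'<i = ⊥-elim (input-fresh i' i 1≤i' i'<i i≤c (sym ai≡ai'))

    orbits-disjoint : ∀ i j i' j' → 1 ≤ i → i ≤ c → 1 ≤ i' → i' ≤ c → seq b (a i) j ≡ seq b (a i') j' → i ≡ i'
    orbits-disjoint i j i' j' 1≤i i≤c 1≤i' i'≤c same = input-injective i i' 1≤i i≤c 1≤i' i'≤c
      (OrbitMin-unique (input-OrbitMin i 1≤i i≤c) (input-OrbitMin i' 1≤i' i'≤c) (j + t)
        (trans (sym (seq-seq (a i) j t)) (trans (cong (λ y → seq b y t) same) back)))
      where
      t = P ∸ j' % P
      back = seq-return (Reduced⇒2*≤b (input-Reduced i' 1≤i' i'≤c)) j'

    OrbitMin⇒input : ∀ {q} → OrbitMin q → ∃[ i ] (1 ≤ i × i ≤ c × a i ≡ q)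
    OrbitMin⇒input {q} q-min@(q-odd , q-red , _) with covered q (q-odd , Reduced⇒RRS* q-red)
    ... | l , 1≤l , l≤c , j , _ , al→q = l , 1≤l , l≤c , OrbitMin-unique (input-OrbitMin l 1≤l l≤c) q-min j al→q

    Entry : ℕ → Set
    Entry x = ∃[ i ] ∃[ j ] (1 ≤ i × i ≤ c × 1 ≤ j × j ≤ P × seq b (a i) j ≡ x)

    -- an even element is reached from its odd part by doubling
    Reduced⇒Entry : ∀ {x} → Reduced x → Entry x
    Reduced⇒Entry {x} x-red with oddPart-Reduced x-red
    ... | o-odd , o-red with covered (oddPart x) (o-odd , Reduced⇒RRS* o-red)
    ...   | l , 1≤l , l≤c , j , _ , al→o with seq-window (a l) (j + v2 x)
    ...     | j' , 1≤j' , j'≤P , window = l , j' , 1≤l , l≤c , 1≤j' , j'≤P , (begin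
      seq b (a l) j'                   ≡⟨ window ⟨
      seq b (a l) (j + v2 x)           ≡⟨ seq-seq (a l) j (v2 x) ⟨
      seq b (seq b (a l) j) (v2 x)     ≡⟨ cong (λ y → seq b y (v2 x)) al→o ⟩
      seq b (oddPart x) (v2 x)         ≡⟨ seq-oddPart x-red ⟩
      x                                ∎)
      where open ≡-Reasoning

    entries⇔RRS* : ∀ x → RRS* b x ⇔ Entry x
    entries⇔RRS* x = mk⇔ (Reduced⇒Entry ∘ RRS*⇒Reduced)
      λ (i , j , 1≤i , i≤c , _ , _ , ai→x) →
        subst (RRS* b) ai→x (Reduced⇒RRS* (seq-Reduced j (Reduced⇒coprime (input-Reduced i 1≤i i≤c))))

    N : ℕ
    N = c * P

    -- the k-th entry of the concatenation MDS(b,1) ⋯ MDS(b,c)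
    entry : ℕ → ℕ
    entry k = seq b (a (suc (k / P))) (suc (k % P))

    1+k/P≤c : ∀ {k} → k < N → suc (k / P) ≤ c
    1+k/P≤c {k} k<N = m<n*o⇒m/o<n {k} {c} {P} k<N

    entry-Reduced : ∀ {k} → k < N → Reduced (entry k)
    entry-Reduced {k} k<N = seq-Reduced (suc (k % P)) (Reduced⇒coprime (input-Reduced (suc (k / P)) (s≤s z≤n) (1+k/P≤c k<N)))

    entry-injective : ∀ k k' → k < N → k' < N → entry k ≡ entry k' → k ≡ k'
    entry-injective k k' k<N k'<N same = %-/-injective r≡ q≡
      where
      q≡ : k / P ≡ k' / P
      q≡ = suc-injective (orbits-disjoint (suc (k / P)) (suc (k % P)) (suc (k' / P)) (suc (k' % P))
                                          (s≤s z≤n) (1+k/P≤c k<N) (s≤s z≤n) (1+k/P≤c k'<N) same)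
      r≡ : k % P ≡ k' % P
      r≡ = seq-injective-period (Reduced⇒coprime (input-Reduced (suc (k / P)) (s≤s z≤n) (1+k/P≤c k<N)))
                                (m%n<n k P) (m%n<n k' P)
                                (trans same (cong (λ i → seq b (a (suc i)) (suc (k' % P))) (sym q≡)))

    Entry⇒entry : ∀ {x} → Entry x → ∃[ k ] (k < N × entry k ≡ x)
    Entry⇒entry (suc i , suc j , _ , 1+i≤c , _ , 1+j≤P , ai→x) =
      k , <-≤-trans (+-monoˡ-< (i * P) 1+j≤P) (*-monoˡ-≤ P 1+i≤c) ,
      trans (cong₂ (λ i j → seq b (a (suc i)) (suc j)) ([r+q*d]/d≡q i 1+j≤P) ([r+q*d]%d≡r i 1+j≤P)) ai→x
      where k = j + i * P

    -- φ(b) counts each entry r and its negative b - r once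
    signedEntry : ℕ → ℕ
    signedEntry k with k <? N
    ... | yes _ = entry k
    ... | no  _ = b ∸ entry (k ∸ N)

    upper-index : ∀ {k} → k < N + N → ¬ k < N → k ∸ N < N
    upper-index {k} k<2N k≮N = +-cancelʳ-< N (k ∸ N) N (subst (_< N + N) (sym (m∸n+n≡m (≮⇒≥ k≮N))) k<2N)

    upper-Reduced : ∀ {k} → k < N + N → ¬ k < N → Reduced (entry (k ∸ N))
    upper-Reduced k<2N k≮N = entry-Reduced (upper-index k<2N k≮N)

    signedEntry-coprime : ∀ {k} → k < N + N → signedEntry k < b × T ⌊ coprime? (signedEntry k) b ⌋
    signedEntry-coprime {k} k<2N with k <? N
    ... | yes k<N = Reduced⇒<b (entry-Reduced k<N) , fromWitness (λ {d} → Reduced⇒coprime (entry-Reduced k<N) {d})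
    ... | no k≮N = ∸-monoʳ-< {b} {entry (k ∸ N)} {0} 1≤y (<⇒≤ y<b) , fromWitness (λ {d} → coprime-b∸ (<⇒≤ y<b) y⊥b {d})
      where
      y-red = upper-Reduced k<2N k≮N
      1≤y = proj₁ y-red
      y<b = Reduced⇒<b y-red
      y⊥b = Reduced⇒coprime y-red

    signedEntry-injective : ∀ k k' → k < N + N → k' < N + N → signedEntry k ≡ signedEntry k' → k ≡ k'
    signedEntry-injective k k' k<2N k'<2N same with k <? N | k' <? N
    ... | yes k<N | yes k'<N = entry-injective k k' k<N k'<N same
    ... | yes k<N | no k'≮N  = ⊥-elim (Reduced≢b∸Reduced {entry k} {entry (k' ∸ N)} (entry-Reduced k<N) (upper-Reduced k'<2N k'≮N) same)
    ... | no k≮N  | yes k'<N = ⊥-elim (Reduced≢b∸Reduced {entry k'} {entry (k ∸ N)} (entry-Reduced k'<N) (upper-Reduced k<2N k≮N) (sym same))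
    ... | no k≮N  | no k'≮N  = ∸-cancelʳ-≡ (≮⇒≥ k≮N) (≮⇒≥ k'≮N)
        (entry-injective (k ∸ N) (k' ∸ N) (upper-index k<2N k≮N) (upper-index k'<2N k'≮N)
          (∸-cancelˡ-≡ {m = b} (<⇒≤ (Reduced⇒<b (upper-Reduced k<2N k≮N))) (<⇒≤ (Reduced⇒<b (upper-Reduced k'<2N k'≮N))) same))

    signedEntry-lower : ∀ {k} → k < N → signedEntry k ≡ entry k
    signedEntry-lower {k} k<N with k <? N
    ... | yes _   = refl
    ... | no k≮N = ⊥-elim (k≮N k<N)

    signedEntry-upper : ∀ k → signedEntry (N + k) ≡ b ∸ entry k
    signedEntry-upper k with N + k <? N
    ... | yes N+k<N = ⊥-elim (<⇒≱ N+k<N (m≤m+n N k))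
    ... | no _      = cong (λ k → b ∸ entry k) (m+n∸m≡n N k)

    signedEntry-onto-lower : ∀ {x} → Reduced x → ∃[ k ] (k < N + N × signedEntry k ≡ x)
    signedEntry-onto-lower x-red = k , ≤-trans k<N (m≤m+n N N) , trans (signedEntry-lower k<N) (proj₂ (proj₂ found))
      where
      found = Entry⇒entry (Reduced⇒Entry x-red)
      k = proj₁ found
      k<N = proj₁ (proj₂ found)

    signedEntry-onto-upper : ∀ {x} → x < b → Reduced (b ∸ x) → ∃[ k ] (k < N + N × signedEntry k ≡ x)
    signedEntry-onto-upper {x} x<b b∸x-red = N + k , +-monoʳ-< N (proj₁ (proj₂ found)) ,
      trans (signedEntry-upper k) (trans (cong (b ∸_) (proj₂ (proj₂ found))) (m∸[m∸n]≡n {b} {x} (<⇒≤ x<b)))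
      where
      found = Entry⇒entry (Reduced⇒Entry b∸x-red)
      k = proj₁ found

    signedEntry-onto : ∀ {x} → x < b → Coprime x b → ∃[ k ] (k < N + N × signedEntry k ≡ x)
    signedEntry-onto {x} x<b x⊥b = case 2 * x ≤? b of λ where
      (yes 2x≤b) → signedEntry-onto-lower (coprime⇒1≤ x⊥b , 2x≤b , x⊥b)
      (no 2x≰b)  → signedEntry-onto-upper x<b (Reduced-b∸ x<b x⊥b (≰⇒> 2x≰b))

    coprimeᵇ : ℕ → Bool
    coprimeᵇ r = ⌊ coprime? r b ⌋

    φ≡2N : φ b ≡ N + N
    φ≡2N = trans (length-filterᵇ-upTo coprimeᵇ b)
                 (count-bijection coprimeᵇ b (N + N) signedEntry (λ k → signedEntry-coprime) signedEntry-injective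
                                  (λ x x<b t → signedEntry-onto x<b (toWitness t)))

    c*P≡φ/2 : c * P ≡ φ b / 2
    c*P≡φ/2 = sym (begin
      φ b / 2      ≡⟨ cong (_/ 2) φ≡2N ⟩
      (N + N) / 2  ≡⟨ cong (λ m → (N + m) / 2) (+-identityʳ N) ⟨
      2 * N / 2    ≡⟨ cong (_/ 2) (*-comm 2 N) ⟩
      N * 2 / 2    ≡⟨ m*n/n≡m N 2 ⟩
      N            ∎)
      where open ≡-Reasoning

    count-OrbitMin : ∀ p → (∀ q → T (p q) ⇔ OrbitMin q) → count p b ≡ c
    count-OrbitMin p p⇔ = count-bijection p b c (λ k → a (suc k)) into injective onto
      where
      into : ∀ k → k < c → a (suc k) < b × T (p (a (suc k)))
      into k k<c = Reduced⇒<b (input-Reduced (suc k) (s≤s z≤n) k<c) ,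
                   Equivalence.from (p⇔ (a (suc k))) (input-OrbitMin (suc k) (s≤s z≤n) k<c)
      injective : ∀ k k' → k < c → k' < c → a (suc k) ≡ a (suc k') → k ≡ k'
      injective k k' k<c k'<c same = suc-injective (input-injective (suc k) (suc k') (s≤s z≤n) k<c (s≤s z≤n) k'<c same)
      onto : ∀ q → q < b → T (p q) → ∃[ k ] (k < c × a (suc k) ≡ q)
      onto q _ pq = index (OrbitMin⇒input (Equivalence.to (p⇔ q) pq))
        where
        index : ∃[ i ] (1 ≤ i × i ≤ c × a i ≡ q) → ∃[ k ] (k < c × a (suc k) ≡ q)
        index (suc k , _ , 1+k≤c , ak≡q) = k , 1+k≤c , ak≡q

    c≡numCoaches : c ≡ numCoaches b
    c≡numCoaches = sym (trans (length-filterᵇ-upTo coachLeaderᵇ b) (count-OrbitMin coachLeaderᵇ T-coachLeaderᵇ))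

    c≡numSchickCycles : c ≡ numSchickCycles b
    c≡numSchickCycles = sym (trans (length-filterᵇ-upTo schickLeaderᵇ b) (count-OrbitMin schickLeaderᵇ T-schickLeaderᵇ))

  c* : ℕ
  c* = count coachLeaderᵇ b

  -- the MDS inputs are the orbit minima in increasing order
  mdsInput : ℕ → ℕ
  mdsInput = nth coachLeaderᵇ b

  mdsInput-OrbitMin : ∀ {i} → 1 ≤ i → i ≤ c* → OrbitMin (mdsInput i)
  mdsInput-OrbitMin 1≤i i≤c* = Equivalence.to (T-coachLeaderᵇ _) (proj₁ (proj₂ (nth-spec coachLeaderᵇ b 1≤i i≤c*)))

  mdsInput-rank : ∀ {x} → OrbitMin x → suc (count coachLeaderᵇ x) ≤ c* × mdsInput (suc (count coachLeaderᵇ x)) ≡ x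
  mdsInput-rank x-min =
    nth-rank coachLeaderᵇ b (Reduced⇒<b (proj₁ (proj₂ x-min))) (Equivalence.from (T-coachLeaderᵇ _) x-min)

  OrbitMin⇒mdsOccurs : ∀ {m x i} → OrbitMin m → count coachLeaderᵇ m < i → ∀ u → 1 ≤ u → seq b m u ≡ x →
                       OccursBefore b mdsInput i x
  OrbitMin⇒mdsOccurs {m} m-min rank<i u 1≤u m→x = suc (count coachLeaderᵇ m) , s≤s z≤n , rank<i , u , 1≤u ,
                                              trans (cong (λ y → seq b y u) (proj₂ (mdsInput-rank m-min))) m→x

  mdsInput-covers : ∀ x → OddRRS b x → OccursBefore b mdsInput c* x
  mdsInput-covers x (x-odd , x-rrs) = let m , m-min , u , 1≤u , m→x = OrbitMin-below x-odd (RRS*⇒Reduced x-rrs)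
                                      in OrbitMin⇒mdsOccurs m-min (proj₁ (mdsInput-rank m-min)) u 1≤u m→x

  mdsInput-fresh : ∀ {i} → i < c* → ¬ OccursBefore b mdsInput i (mdsInput (suc i))
  mdsInput-fresh {i} i<c* (suc l , _ , l<i , j , _ , l→y) = <⇒≢ l<i (begin
    l                                         ≡⟨ proj₂ (proj₂ (nth-spec coachLeaderᵇ b (s≤s z≤n) l<c*)) ⟨
    count coachLeaderᵇ (mdsInput (suc l))     ≡⟨ cong (count coachLeaderᵇ) same ⟩
    count coachLeaderᵇ (mdsInput (suc i))     ≡⟨ proj₂ (proj₂ (nth-spec coachLeaderᵇ b (s≤s z≤n) i<c*)) ⟩
    i                                         ∎)
    where
    open ≡-Reasoning
    l<c* = ≤-trans l<i (<⇒≤ i<c*)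
    same = OrbitMin-unique (mdsInput-OrbitMin (s≤s z≤n) l<c*) (mdsInput-OrbitMin (s≤s z≤n) i<c*) j l→y

  mdsInput-≤-OrbitMin : ∀ {i m} → i < c* → OrbitMin m → i ≤ count coachLeaderᵇ m → mdsInput (suc i) ≤ m
  mdsInput-≤-OrbitMin {i} {m} i<c* m-min i≤rank = ≮⇒≥ λ m<y →
    <⇒≱ (count-strict coachLeaderᵇ (Equivalence.from (T-coachLeaderᵇ m) m-min) m<y)
        (subst (_≤ count coachLeaderᵇ m) (sym (proj₂ (proj₂ (nth-spec coachLeaderᵇ b (s≤s z≤n) i<c*)))) i≤rank)

  -- an odd x unseen before step i lies in the orbit of an orbit minimum of rank ≥ i
  mdsInput-least : ∀ {i x} → i < c* → OddRRS b x → ¬ OccursBefore b mdsInput i x → mdsInput (suc i) ≤ x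
  mdsInput-least i<c* (x-odd , x-rrs) unseen =
    let m , m-min , u , 1≤u , m→x = OrbitMin-below x-odd (RRS*⇒Reduced x-rrs)
    in ≤-trans (mdsInput-≤-OrbitMin i<c* m-min (≮⇒≥ λ rank<i → unseen (OrbitMin⇒mdsOccurs m-min rank<i u 1≤u m→x)))
               (subst (m ≤_) m→x (OrbitMin-≤ m-min u (subst Odd (sym m→x) x-odd)))

  mdsInput-IsMDSInputs : IsMDSInputs b c* mdsInput
  mdsInput-IsMDSInputs = ≤-trans (s≤s z≤n) (proj₁ (mdsInput-rank OrbitMin-1)) , proj₂ (mdsInput-rank OrbitMin-1) ,
    (λ i _ i<c* → let y-min = mdsInput-OrbitMin (s≤s z≤n) i<c*
                  in (proj₁ y-min , Reduced⇒RRS* (proj₁ (proj₂ y-min))) , mdsInput-fresh i<c* , λ x → mdsInput-least i<c*) ,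
    mdsInput-covers

proposition12 : ∀ (b : ℕ) → 3 ≤ b → Odd b →
    Σ ℕ λ P →
      -- 1. every such sequence is purely periodic with the same primitive period P = P(b)
      (∀ a → OddRRS b a → IsPrimPeriod b a P) ×
      -- 2. P(b) is the least k ≥ 1 with 2^k ≡ ±1 (mod b); P(b) = k(b) = pes(b)
      IsLeastPos (PlusMinusOne b) P ×
      (Σ ℕ λ r → CoachLength b 1 r × coachK b 1 r ≡ P) ×
      IsPes b P ×
      -- the MDS system terminates
      (Σ ℕ λ c → Σ (ℕ → ℕ) λ a → IsMDSInputs b c a) ×
      (∀ c a → IsMDSInputs b c a →
        -- 3. last entry of MDS(b,i) is the input a(b,i)
        (∀ i → 1 ≤ i → i ≤ c → seq b (a i) P ≡ a i) ×
        -- 4. union of the entries of MDS(b,1..c*) is RRS*(b)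
        (∀ x → RRS* b x ⇔ (∃[ i ] ∃[ j ] (1 ≤ i × i ≤ c × 1 ≤ j × j ≤ P × seq b (a i) j ≡ x))) ×
        -- 5. c* P = φ(b)/2, and c* = c(b) = B(b)
        c * P ≡ φ b / 2 ×
        c ≡ numCoaches b ×
        c ≡ numSchickCycles b)
proposition12 zero () _
proposition12 (suc n) 3≤b b-odd =
  P , P-IsPrimPeriod , P-IsLeastPos-PlusMinusOne , coach₁ , P-IsPes , (c* , mdsInput , mdsInput-IsMDSInputs) ,
  λ c a inputs → let open MDS c a inputs in last-entry , entries⇔RRS* , c*P≡φ/2 , c≡numCoaches , c≡numSchickCycles
  where open OddModulus n 3≤b b-odd
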